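{- Let $0<|q|<1$ and $a\in\mathbb{C}$. Then $$\sum_{n=0}^{\infty}\mathcal{R}_{q}(cq^{n})\frac{(a;q)_{n}(b;q)_{n}}{(q;q)_{n}}z^{n}=\frac{(b;q)_{\infty}(az;q)_{\infty}}{(z;q)_{\infty}}\sum_{n=0}^{\infty}\mathrm{S}_{n}(c/b;q)\frac{(z;q)_{n}}{(az;q)_{n}(q;q)_{n}}b^{n},$$ where $\mathrm{S}_{n}(c/b;q)\,b^{n}=\sum_{k=0}^{n}\genfrac{[}{]}{0pt}{}{n}{k}_{q}q^{k^2}c^{k}b^{n-k}$.
   Context: $(a;q)_n=\prod_{k=0}^{n-1}(1-aq^k)$, $(a;q)_\infty=\prod_{k\ge0}(1-aq^k)$, $\genfrac{[}{]}{0pt}{}{n}{k}_{q}=\frac{(q;q)_n}{(q;q)_k(q;q)_{n-k}}$. The Rogers–Ramanujan function is $\mathcal{R}_{q}(w)=\sum_{n=0}^{\infty}q^{n^{2}}\frac{w^{n}}{(q;q)_{n}}$, and the (Stieltjes–Wigert type) polynomials are $\mathrm{S}_{n}(x;q)=\sum_{k=0}^{n}\genfrac{[}{]}{0pt}{}{n}{k}_{q}q^{k^{2}}x^{k}$. The identity is understood as an identity of formal power series in $b$, $c$, $z$. -}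

module Defs where

-- Formal power series in the five commuting indeterminates q, a, b, c, z
-- with integer coefficients.  A series is given by its coefficient function:
--   f i j k l m  =  coefficient of  q^i a^j b^k c^l z^m .

open import Data.Nat as ℕ using (ℕ; zero; suc; _∸_; _≡ᵇ_)
open import Data.Bool using (if_then_else_)
open import Data.Integer as ℤ using (ℤ)

PS : Set
PS = ℕ → ℕ → ℕ → ℕ → ℕ → ℤ

sumTo : ℕ → (ℕ → ℤ) → ℤ
sumTo zero    f = f 0
sumTo (suc n) f = sumTo n f ℤ.+ f (suc n)

δ : ℕ → ℕ → ℤ
δ p n = if p ≡ᵇ n then ℤ.1ℤ else ℤ.0ℤ

mono : ℕ → ℕ → ℕ → ℕ → ℕ → PS
mono p1 p2 p3 p4 p5 i j k l m =
  δ p1 i ℤ.* (δ p2 j ℤ.* (δ p3 k ℤ.* (δ p4 l ℤ.* δ p5 m)))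

𝟙 Q A B C Z : PS
𝟙 = mono 0 0 0 0 0
Q = mono 1 0 0 0 0
A = mono 0 1 0 0 0
B = mono 0 0 1 0 0
C = mono 0 0 0 1 0
Z = mono 0 0 0 0 1

infixl 6 _⊕_ _⊖_
infixl 7 _⊛_

_⊕_ : PS → PS → PS
(f ⊕ g) i j k l m = f i j k l m ℤ.+ g i j k l m

_⊖_ : PS → PS → PS
(f ⊖ g) i j k l m = f i j k l m ℤ.- g i j k l m

_⊛_ : PS → PS → PS
(f ⊛ g) i j k l m =
  sumTo i λ i₁ → sumTo j λ j₁ → sumTo k λ k₁ → sumTo l λ l₁ → sumTo m λ m₁ →
    f i₁ j₁ k₁ l₁ m₁ ℤ.* g (i ∸ i₁) (j ∸ j₁) (k ∸ k₁) (l ∸ l₁) (m ∸ m₁)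

_^^_ : PS → ℕ → PS
x ^^ zero  = 𝟙
x ^^ suc n = x ⊛ (x ^^ n)

deg : ℕ → ℕ → ℕ → ℕ → ℕ → ℕ
deg i j k l m = i ℕ.+ j ℕ.+ k ℕ.+ l ℕ.+ m

-- Infinite sum Σ_{n≥0} f n.  Used only for families where every monomial of
-- f n has total degree ≥ n, so the coefficient of a monomial of degree d
-- receives contributions only from n ≤ d (the sum is formally convergent).
Σ∞ : (ℕ → PS) → PS
Σ∞ f i j k l m = sumTo (deg i j k l m) λ n → f n i j k l m

Π< : ℕ → (ℕ → PS) → PS
Π< zero    f = 𝟙
Π< (suc n) f = Π< n f ⊛ f n

-- Infinite product Π_{k≥0} f k.  Used only for families with
-- f k − 1 having all monomials of total degree > k, so the coefficient of
-- a monomial of degree d is that of the finite product Π_{k≤d} f k.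
Π∞ : (ℕ → PS) → PS
Π∞ f i j k l m = Π< (suc (deg i j k l m)) f i j k l m

geom : PS → PS
geom x = Σ∞ λ n → x ^^ n

poch : PS → ℕ → PS
poch x n = Π< n λ k → 𝟙 ⊖ x ⊛ (Q ^^ k)

poch∞ : PS → PS
poch∞ x = Π∞ λ k → 𝟙 ⊖ x ⊛ (Q ^^ k)

invPoch : PS → ℕ → PS
invPoch x n = Π< n λ k → geom (x ⊛ (Q ^^ k))

invPoch∞ : PS → PS
invPoch∞ x = Π∞ λ k → geom (x ⊛ (Q ^^ k))

invQQ : ℕ → PS
invQQ n = Π< n λ i → geom (Q ^^ suc i)

qbinom : ℕ → ℕ → PS
qbinom n k = poch Q n ⊛ invQQ k ⊛ invQQ (n ∸ k)

-- Rogers–Ramanujan function R_q(w) = Σ_n q^{n²} w^n / (q;q)_n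
RR : PS → PS
RR w = Σ∞ λ n → (Q ^^ (n ℕ.* n)) ⊛ (w ^^ n) ⊛ invQQ n

SnB : ℕ → PS
SnB n = sumPS n
  where
  term : ℕ → PS
  term k = qbinom n k ⊛ (Q ^^ (k ℕ.* k)) ⊛ (C ^^ k) ⊛ (B ^^ (n ∸ k))
  sumPS : ℕ → PS
  sumPS zero    = term 0
  sumPS (suc t) = sumPS t ⊕ term (suc t)

LHS : PS
LHS = Σ∞ λ n → RR (C ⊛ (Q ^^ n)) ⊛ poch A n ⊛ poch B n ⊛ invQQ n ⊛ (Z ^^ n)

RHS : PS
RHS = poch∞ B ⊛ poch∞ (A ⊛ Z) ⊛ invPoch∞ Z ⊛
      (Σ∞ λ n → SnB n ⊛ poch Z n ⊛ invPoch (A ⊛ Z) n ⊛ invQQ n)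

{-# OPTIONS --safe #-}
module Submission where

-- A coefficient of total degree d only depends on the image of a series in
-- the ring of series modulo total degree > d.  There the infinite sums of
-- the statement become sums up to d, and (x;q)∞ becomes the product of its
-- first d + 1 factors, so the identity can be proved by finite algebra.
--
-- Expanding R_q(cqⁿ) and exchanging the sums turns the left side into
-- Σₖ q^{k²} cᵏ/(q;q)ₖ · φ(zqᵏ), where φ(x) = Σₙ (a;q)ₙ (b;q)ₙ/(q;q)ₙ xⁿ.
-- On the right, expanding Sₙ and reindexing by (k, n − k) produces the same
-- weights times (b;q)∞ (az;q)∞/(z;q)∞ Σₘ bᵐ/(q;q)ₘ (z;q)ₖ₊ₘ/(az;q)ₖ₊ₘ,
-- which is φ(zqᵏ) by Heine's argument: write (b;q)ₙ = (b;q)∞/(bqⁿ;q)∞,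
-- expand 1/(bqⁿ;q)∞ by Euler's formula and sum over n with the q-binomial
-- theorem.  The q-binomial theorem in turn follows by iterating the
-- functional equation f(x)(1 − x) = (1 − αx) f(qx) of its series.

open import Level using (0ℓ)
open import Algebra.Bundles using (CommutativeRing)
open import Algebra.Structures using (IsCommutativeRing)
import Algebra.Solver.Ring
open import Algebra.Solver.Ring.AlmostCommutativeRing using (fromCommutativeRing; _-Raw-AlmostCommutative⟶_)
open import Data.Nat as ℕ using (ℕ; zero; suc; _∸_; _≤_; _<_; z≤n; s≤s)
import Data.Nat.Properties as ℕₚ
open import Data.Integer as ℤ using (ℤ; 0ℤ; +_; -[1+_])
import Data.Integer.Properties as ℤₚ
open import Data.Sign as Sign using (Sign)
open import Data.Maybe using (Maybe; just; nothing)
open import Data.Unit using (⊤; tt)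
open import Data.Product using (_,_)
open import Relation.Nullary using (yes; no)
open import Relation.Binary.PropositionalEquality as ≡ using (_≡_)
open import Defs as Defs using (PS; deg; sumTo; 𝟙; Q; A; B; C; Z; _⊛_; _^^_; Σ∞; Π<; Π∞; LHS; RHS)

-- Algebra.Solver.Ring needs coefficients with decidable equality, and ℤ maps
-- into every commutative ring.
module IntegerRingSolver {c ℓ} (R : CommutativeRing c ℓ) where
  open CommutativeRing R
  open import Algebra.Properties.Ring ring using (-‿distribˡ-*; -‿distribʳ-*; -0#≈0#; -‿involutive; -‿+-comm)
  open import Algebra.Properties.Semiring.Mult.TCOptimised semiring using (_×_; 1+×; ×-homo-+; ×1-homo-*)
  open import Algebra.Properties.CommutativeSemigroup +-commutativeSemigroup using (interchange)
  open import Relation.Binary.Reasoning.Setoid setoid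

  ⟦_⟧ℤ : ℤ → Carrier
  ⟦ + n ⟧ℤ      = n × 1#
  ⟦ -[1+ n ] ⟧ℤ = - (suc n × 1#)

  ⊖-homo : ∀ m n → ⟦ m ℤ.⊖ n ⟧ℤ ≈ m × 1# - n × 1#
  ⊖-homo m       zero    = sym (trans (+-congˡ -0#≈0#) (+-identityʳ _))
  ⊖-homo zero    (suc n) = sym (+-identityˡ _)
  ⊖-homo (suc m) (suc n) = begin
    ⟦ suc m ℤ.⊖ suc n ⟧ℤ            ≡⟨ ≡.cong ⟦_⟧ℤ (ℤₚ.[1+m]⊖[1+n]≡m⊖n m n) ⟩
    ⟦ m ℤ.⊖ n ⟧ℤ                    ≈⟨ ⊖-homo m n ⟩
    m × 1# - n × 1#                 ≈⟨ +-identityˡ _ ⟨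
    0# + (m × 1# - n × 1#)          ≈⟨ +-congʳ (-‿inverseʳ 1#) ⟨
    (1# - 1#) + (m × 1# - n × 1#)   ≈⟨ interchange _ _ _ _ ⟩
    (1# + m × 1#) + (- 1# - n × 1#) ≈⟨ +-cong (1+× m 1#) (trans (-‿cong (1+× n 1#)) (sym (-‿+-comm _ _))) ⟨
    suc m × 1# - suc n × 1#         ∎

  +-homo : ∀ i j → ⟦ i ℤ.+ j ⟧ℤ ≈ ⟦ i ⟧ℤ + ⟦ j ⟧ℤ
  +-homo (+ m)      (+ n)      = ×-homo-+ 1# m n
  +-homo (+ m)      -[1+ n ]   = ⊖-homo m (suc n)
  +-homo -[1+ m ]   (+ n)      = trans (⊖-homo n (suc m)) (+-comm _ _)
  +-homo -[1+ m ]   -[1+ n ]   = begin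
    - (suc (suc (m ℕ.+ n)) × 1#)    ≡⟨ ≡.cong (λ k → - (suc k × 1#)) (≡.sym (ℕₚ.+-suc m n)) ⟩
    - ((suc m ℕ.+ suc n) × 1#)      ≈⟨ -‿cong (×-homo-+ 1# (suc m) (suc n)) ⟩
    - (suc m × 1# + suc n × 1#)     ≈⟨ -‿+-comm _ _ ⟨
    - (suc m × 1#) + - (suc n × 1#) ∎

  -‿homo : ∀ i → ⟦ ℤ.- i ⟧ℤ ≈ - ⟦ i ⟧ℤ
  -‿homo -[1+ n ]    = sym (-‿involutive _)
  -‿homo (+ zero)    = sym -0#≈0#
  -‿homo (+ suc n)   = refl

  signed : Sign → Carrier → Carrier
  signed Sign.+ x = x
  signed Sign.- x = - x

  signed-cong : ∀ s {x y} → x ≈ y → signed s x ≈ signed s y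
  signed-cong Sign.+ x≈y = x≈y
  signed-cong Sign.- x≈y = -‿cong x≈y

  ◃-homo : ∀ s n → ⟦ s ℤ.◃ n ⟧ℤ ≈ signed s (n × 1#)
  ◃-homo Sign.+ zero    = refl
  ◃-homo Sign.- zero    = sym -0#≈0#
  ◃-homo Sign.+ (suc n) = refl
  ◃-homo Sign.- (suc n) = refl

  signed-abs : ∀ i → ⟦ i ⟧ℤ ≈ signed (ℤ.sign i) (ℤ.∣ i ∣ × 1#)
  signed-abs (+ n)      = refl
  signed-abs -[1+ n ]   = refl

  signed-* : ∀ s t x y → signed (s Sign.* t) (x * y) ≈ signed s x * signed t y
  signed-* Sign.+ Sign.+ x y = refl
  signed-* Sign.+ Sign.- x y = -‿distribʳ-* x y
  signed-* Sign.- Sign.+ x y = -‿distribˡ-* x y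
  signed-* Sign.- Sign.- x y = begin
    x * y       ≈⟨ -‿involutive _ ⟨
    - - (x * y) ≈⟨ -‿cong (-‿distribˡ-* x y) ⟩
    - (- x * y) ≈⟨ -‿distribʳ-* (- x) y ⟩
    - x * - y   ∎

  *-homo : ∀ i j → ⟦ i ℤ.* j ⟧ℤ ≈ ⟦ i ⟧ℤ * ⟦ j ⟧ℤ
  *-homo i j = begin
    ⟦ (s Sign.* t) ℤ.◃ (m ℕ.* n) ⟧ℤ       ≈⟨ ◃-homo (s Sign.* t) (m ℕ.* n) ⟩
    signed (s Sign.* t) ((m ℕ.* n) × 1#)  ≈⟨ signed-cong (s Sign.* t) (×1-homo-* m n) ⟩
    signed (s Sign.* t) (m × 1# * n × 1#) ≈⟨ signed-* s t (m × 1#) (n × 1#) ⟩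
    signed s (m × 1#) * signed t (n × 1#) ≈⟨ *-cong (signed-abs i) (signed-abs j) ⟨
    ⟦ i ⟧ℤ * ⟦ j ⟧ℤ                       ∎
    where
    s = ℤ.sign i
    t = ℤ.sign j
    m = ℤ.∣ i ∣
    n = ℤ.∣ j ∣

  ℤ⟶R : ℤ.+-*-rawRing -Raw-AlmostCommutative⟶ fromCommutativeRing R
  ℤ⟶R = record
    { ⟦_⟧    = ⟦_⟧ℤ
    ; +-homo = +-homo
    ; *-homo = *-homo
    ; -‿homo = -‿homo
    ; 0-homo = refl
    ; 1-homo = refl
    }

  coefficient-test : ∀ i j → Maybe (⟦ i ⟧ℤ ≈ ⟦ j ⟧ℤ)
  coefficient-test i j with i ℤₚ.≟ j
  ... | yes ≡.refl = just refl
  ... | no _       = nothing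

  open Algebra.Solver.Ring ℤ.+-*-rawRing (fromCommutativeRing R) ℤ⟶R coefficient-test public

module DifferenceIdentities {c ℓ} (R : CommutativeRing c ℓ) where
  open CommutativeRing R
  open IntegerRingSolver R using (solve; _:=_; _:+_; _:*_; :-_; _:-_; con)

  y-x≈-[x-y] : ∀ x y → y - x ≈ - (x - y)
  y-x≈-[x-y] = solve 2 (λ x y → y :- x := :- (x :- y)) refl

  x-z≈[x-y]+[y-z] : ∀ x y z → x - z ≈ (x - y) + (y - z)
  x-z≈[x-y]+[y-z] = solve 3 (λ x y z → x :- z := (x :- y) :+ (y :- z)) refl

  [x+u]-[y+v]≈[x-y]+[u-v] : ∀ x u y v → (x + u) - (y + v) ≈ (x - y) + (u - v)
  [x+u]-[y+v]≈[x-y]+[u-v] = solve 4 (λ x u y v → (x :+ u) :- (y :+ v) := (x :- y) :+ (u :- v)) refl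

  [-x]-[-y]≈-[x-y] : ∀ x y → - x - - y ≈ - (x - y)
  [-x]-[-y]≈-[x-y] = solve 2 (λ x y → :- x :- :- y := :- (x :- y)) refl

  xu-yv≈[x-y]u+y[u-v] : ∀ x u y v → x * u - y * v ≈ (x - y) * u + y * (u - v)
  xu-yv≈[x-y]u+y[u-v] = solve 4 (λ x u y v → x :* u :- y :* v := (x :- y) :* u :+ y :* (u :- v)) refl

  [x+y]-z≈[x-z]+y : ∀ x y z → (x + y) - z ≈ (x - z) + y
  [x+y]-z≈[x-z]+y = solve 3 (λ x y z → (x :+ y) :- z := (x :- z) :+ y) refl

  xy-z≈x[y-1]+[x-z] : ∀ x y z → x * y - z ≈ x * (y - 1#) + (x - z)
  xy-z≈x[y-1]+[x-z] = solve 3 (λ x y z → x :* y :- z := x :* (y :- con (+ 1)) :+ (x :- z)) refl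

  [1-x]-1≈-x : ∀ x → (1# - x) - 1# ≈ - x
  [1-x]-1≈-x = solve 1 (λ x → (con (+ 1) :- x) :- con (+ 1) := :- x) refl

module FiniteSums {c ℓ} (R : CommutativeRing c ℓ)
  (∑ : ℕ → (ℕ → CommutativeRing.Carrier R) → CommutativeRing.Carrier R)
  (∑-zero : ∀ f → CommutativeRing._≈_ R (∑ 0 f) (f 0))
  (∑-suc : ∀ n f → CommutativeRing._≈_ R (∑ (suc n) f) (CommutativeRing._+_ R (∑ n f) (f (suc n))))
  where
  open CommutativeRing R

  open import Relation.Binary.Reasoning.Setoid setoid
  open import Algebra.Properties.CommutativeSemigroup +-commutativeSemigroup using (interchange)
  open import Algebra.Properties.Ring ring using (-‿+-comm)

  ≡⇒≈ : ∀ {x y} → x ≡ y → x ≈ y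
  ≡⇒≈ ≡.refl = refl

  ∑-cong≤ : ∀ n {f g : ℕ → Carrier} → (∀ i → i ≤ n → f i ≈ g i) → ∑ n f ≈ ∑ n g
  ∑-cong≤ zero    {f} {g} f≈g = begin
    ∑ 0 f ≈⟨ ∑-zero f ⟩
    f 0   ≈⟨ f≈g 0 z≤n ⟩
    g 0   ≈⟨ ∑-zero g ⟨
    ∑ 0 g ∎
  ∑-cong≤ (suc n) {f} {g} f≈g = begin
    ∑ (suc n) f       ≈⟨ ∑-suc n f ⟩
    ∑ n f + f (suc n) ≈⟨ +-cong (∑-cong≤ n (λ i i≤n → f≈g i (ℕₚ.m≤n⇒m≤1+n i≤n))) (f≈g (suc n) ℕₚ.≤-refl) ⟩
    ∑ n g + g (suc n) ≈⟨ ∑-suc n g ⟨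
    ∑ (suc n) g       ∎

  ∑-cong : ∀ n {f g : ℕ → Carrier} → (∀ i → f i ≈ g i) → ∑ n f ≈ ∑ n g
  ∑-cong n f≈g = ∑-cong≤ n (λ i _ → f≈g i)

  ∑-index : ∀ {m n} (f : ℕ → Carrier) → m ≡ n → ∑ m f ≈ ∑ n f
  ∑-index f ≡.refl = refl

  ∑-vanishes : ∀ n {f : ℕ → Carrier} → (∀ i → i ≤ n → f i ≈ 0#) → ∑ n f ≈ 0#
  ∑-vanishes zero    {f} f≈0 = trans (∑-zero f) (f≈0 0 z≤n)
  ∑-vanishes (suc n) {f} f≈0 = begin
    ∑ (suc n) f       ≈⟨ ∑-suc n f ⟩
    ∑ n f + f (suc n) ≈⟨ +-cong (∑-vanishes n (λ i i≤n → f≈0 i (ℕₚ.m≤n⇒m≤1+n i≤n))) (f≈0 (suc n) ℕₚ.≤-refl) ⟩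
    0# + 0#           ≈⟨ +-identityˡ 0# ⟩
    0#                ∎

  ∑-+ : ∀ n (f g : ℕ → Carrier) → ∑ n (λ i → f i + g i) ≈ ∑ n f + ∑ n g
  ∑-+ zero    f g = trans (∑-zero _) (sym (+-cong (∑-zero f) (∑-zero g)))
  ∑-+ (suc n) f g = begin
    ∑ (suc n) (λ i → f i + g i)                     ≈⟨ ∑-suc n _ ⟩
    ∑ n (λ i → f i + g i) + (f (suc n) + g (suc n)) ≈⟨ +-congʳ (∑-+ n f g) ⟩
    (∑ n f + ∑ n g) + (f (suc n) + g (suc n))       ≈⟨ interchange _ _ _ _ ⟩
    (∑ n f + f (suc n)) + (∑ n g + g (suc n))       ≈⟨ +-cong (∑-suc n f) (∑-suc n g) ⟨
    ∑ (suc n) f + ∑ (suc n) g                       ∎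

  ∑-neg : ∀ n (f : ℕ → Carrier) → ∑ n (λ i → - f i) ≈ - ∑ n f
  ∑-neg zero    f = trans (∑-zero _) (-‿cong (sym (∑-zero f)))
  ∑-neg (suc n) f = begin
    ∑ (suc n) (λ i → - f i)         ≈⟨ ∑-suc n _ ⟩
    ∑ n (λ i → - f i) + - f (suc n) ≈⟨ +-congʳ (∑-neg n f) ⟩
    - ∑ n f + - f (suc n)           ≈⟨ -‿+-comm _ _ ⟩
    - (∑ n f + f (suc n))           ≈⟨ -‿cong (∑-suc n f) ⟨
    - ∑ (suc n) f                   ∎

  ∑-- : ∀ n (f g : ℕ → Carrier) → ∑ n (λ i → f i - g i) ≈ ∑ n f - ∑ n g
  ∑-- n f g = trans (∑-+ n f (λ i → - g i)) (+-congˡ (∑-neg n g))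

  *-distribˡ-∑ : ∀ n x (f : ℕ → Carrier) → x * ∑ n f ≈ ∑ n (λ i → x * f i)
  *-distribˡ-∑ zero    x f = trans (*-congˡ (∑-zero f)) (sym (∑-zero _))
  *-distribˡ-∑ (suc n) x f = begin
    x * ∑ (suc n) f                     ≈⟨ *-congˡ (∑-suc n f) ⟩
    x * (∑ n f + f (suc n))             ≈⟨ distribˡ x _ _ ⟩
    x * ∑ n f + x * f (suc n)           ≈⟨ +-congʳ (*-distribˡ-∑ n x f) ⟩
    ∑ n (λ i → x * f i) + x * f (suc n) ≈⟨ ∑-suc n _ ⟨
    ∑ (suc n) (λ i → x * f i)           ∎

  *-distribʳ-∑ : ∀ n x (f : ℕ → Carrier) → ∑ n f * x ≈ ∑ n (λ i → f i * x)
  *-distribʳ-∑ n x f = begin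
    ∑ n f * x           ≈⟨ *-comm _ x ⟩
    x * ∑ n f           ≈⟨ *-distribˡ-∑ n x f ⟩
    ∑ n (λ i → x * f i) ≈⟨ ∑-cong n (λ i → *-comm x (f i)) ⟩
    ∑ n (λ i → f i * x) ∎

  ∑-head : ∀ n (f : ℕ → Carrier) → ∑ (suc n) f ≈ f 0 + ∑ n (λ i → f (suc i))
  ∑-head zero    f = trans (∑-suc 0 f) (+-cong (∑-zero f) (sym (∑-zero _)))
  ∑-head (suc n) f = begin
    ∑ (suc (suc n)) f                               ≈⟨ ∑-suc (suc n) f ⟩
    ∑ (suc n) f + f (suc (suc n))                   ≈⟨ +-congʳ (∑-head n f) ⟩
    (f 0 + ∑ n (λ i → f (suc i))) + f (suc (suc n)) ≈⟨ +-assoc _ _ _ ⟩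
    f 0 + (∑ n (λ i → f (suc i)) + f (suc (suc n))) ≈⟨ +-congˡ (∑-suc n _) ⟨
    f 0 + ∑ (suc n) (λ i → f (suc i))               ∎

  ∑-reverse : ∀ n (f : ℕ → Carrier) → ∑ n f ≈ ∑ n (λ i → f (n ∸ i))
  ∑-reverse zero    f = trans (∑-zero f) (sym (∑-zero _))
  ∑-reverse (suc n) f = begin
    ∑ (suc n) f                       ≈⟨ ∑-suc n f ⟩
    ∑ n f + f (suc n)                 ≈⟨ +-congʳ (∑-reverse n f) ⟩
    ∑ n (λ i → f (n ∸ i)) + f (suc n) ≈⟨ +-comm _ _ ⟩
    f (suc n) + ∑ n (λ i → f (n ∸ i)) ≈⟨ ∑-head n _ ⟨
    ∑ (suc n) (λ i → f (suc n ∸ i))   ∎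

  ∑-comm : ∀ m n (G : ℕ → ℕ → Carrier) →
           ∑ m (λ i → ∑ n (λ j → G i j)) ≈ ∑ n (λ j → ∑ m (λ i → G i j))
  ∑-comm zero    n G = trans (∑-zero _) (∑-cong n (λ j → sym (∑-zero _)))
  ∑-comm (suc m) n G = begin
    ∑ (suc m) (λ i → ∑ n (G i))                     ≈⟨ ∑-suc m _ ⟩
    ∑ m (λ i → ∑ n (G i)) + ∑ n (G (suc m))         ≈⟨ +-congʳ (∑-comm m n G) ⟩
    ∑ n (λ j → ∑ m (λ i → G i j)) + ∑ n (G (suc m)) ≈⟨ ∑-+ n _ _ ⟨
    ∑ n (λ j → ∑ m (λ i → G i j) + G (suc m) j)     ≈⟨ ∑-cong n (λ j → ∑-suc m _) ⟨
    ∑ n (λ j → ∑ (suc m) (λ i → G i j))             ∎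

  ∑-triangle : ∀ n (G : ℕ → ℕ → Carrier) →
               ∑ n (λ i → ∑ (n ∸ i) (λ t → G i (i ℕ.+ t))) ≈ ∑ n (λ s → ∑ s (λ i → G i s))
  ∑-triangle zero    G = begin
    ∑ 0 (λ i → ∑ (0 ∸ i) (λ t → G i (i ℕ.+ t))) ≈⟨ ∑-zero _ ⟩
    ∑ 0 (G 0)                                   ≈⟨ ∑-zero _ ⟩
    G 0 0                                       ≈⟨ ∑-zero (λ i → G i 0) ⟨
    ∑ 0 (λ i → G i 0)                           ≈⟨ ∑-zero _ ⟨
    ∑ 0 (λ s → ∑ s (λ i → G i s))               ∎
  ∑-triangle (suc n) G = begin
    ∑ (suc n) (λ i → Row (suc n) i)                               ≈⟨ ∑-suc n _ ⟩
    ∑ n (λ i → Row (suc n) i) + Row (suc n) (suc n)               ≈⟨ +-cong (∑-cong≤ n row-suc) last-row ⟩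
    ∑ n (λ i → Row n i + G i (suc n)) + G (suc n) (suc n)         ≈⟨ +-congʳ (∑-+ n _ _) ⟩
    (∑ n (Row n) + ∑ n (λ i → G i (suc n))) + G (suc n) (suc n)   ≈⟨ +-assoc _ _ _ ⟩
    ∑ n (Row n) + (∑ n (λ i → G i (suc n)) + G (suc n) (suc n))   ≈⟨ +-cong (∑-triangle n G) (sym (∑-suc n _)) ⟩
    ∑ n (λ s → ∑ s (λ i → G i s)) + ∑ (suc n) (λ i → G i (suc n)) ≈⟨ ∑-suc n _ ⟨
    ∑ (suc n) (λ s → ∑ s (λ i → G i s))                           ∎
    where
    Row : ℕ → ℕ → Carrier
    Row m i = ∑ (m ∸ i) (λ t → G i (i ℕ.+ t))

    last-row : Row (suc n) (suc n) ≈ G (suc n) (suc n)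
    last-row = begin
      ∑ (n ∸ n) (λ t → G (suc n) (suc n ℕ.+ t)) ≈⟨ ∑-index _ (ℕₚ.n∸n≡0 n) ⟩
      ∑ 0 (λ t → G (suc n) (suc n ℕ.+ t))       ≈⟨ ∑-zero _ ⟩
      G (suc n) (suc n ℕ.+ 0)                   ≈⟨ ≡⇒≈ (≡.cong (G (suc n)) (ℕₚ.+-identityʳ (suc n))) ⟩
      G (suc n) (suc n)                         ∎

    row-suc : ∀ i → i ≤ n → Row (suc n) i ≈ Row n i + G i (suc n)
    row-suc i i≤n = begin
      ∑ (suc n ∸ i) (λ t → G i (i ℕ.+ t))   ≈⟨ ∑-index _ (ℕₚ.+-∸-assoc 1 i≤n) ⟩
      ∑ (suc (n ∸ i)) (λ t → G i (i ℕ.+ t)) ≈⟨ ∑-suc (n ∸ i) _ ⟩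
      Row n i + G i (i ℕ.+ suc (n ∸ i))     ≈⟨ +-congˡ (≡⇒≈ (≡.cong (G i) i+[1+n∸i]≡1+n)) ⟩
      Row n i + G i (suc n)                 ∎
      where
      i+[1+n∸i]≡1+n : i ℕ.+ suc (n ∸ i) ≡ suc n
      i+[1+n∸i]≡1+n = ≡.trans (ℕₚ.+-suc i (n ∸ i)) (≡.cong suc (ℕₚ.m+[n∸m]≡n i≤n))

  ∑-pad : ∀ n {f : ℕ → Carrier} t → (∀ m → n < m → m ≤ t ℕ.+ n → f m ≈ 0#) → ∑ (t ℕ.+ n) f ≈ ∑ n f
  ∑-pad n     zero    f≈0 = refl
  ∑-pad n {f} (suc t) f≈0 = begin
    ∑ (suc (t ℕ.+ n)) f             ≈⟨ ∑-suc (t ℕ.+ n) f ⟩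
    ∑ (t ℕ.+ n) f + f (suc (t ℕ.+ n)) ≈⟨ +-cong (∑-pad n t (λ m n<m m≤t+n → f≈0 m n<m (ℕₚ.m≤n⇒m≤1+n m≤t+n)))
                                             (f≈0 _ (s≤s (ℕₚ.m≤n+m n t)) ℕₚ.≤-refl) ⟩
    ∑ n f + 0#                    ≈⟨ +-identityʳ _ ⟩
    ∑ n f                         ∎

-- ∑ is a field, not defined from _+_, so that in the series rings below it
-- is definitionally the coefficientwise sum (as are sumTo and Σ∞ in Defs).
record FilteredRing : Set₁ where
  field
    commutativeRing : CommutativeRing 0ℓ 0ℓ
  open CommutativeRing commutativeRing public
  field
    ∑           : ℕ → (ℕ → Carrier) → Carrier
    ∑-zero      : ∀ f → ∑ 0 f ≈ f 0
    ∑-suc       : ∀ n f → ∑ (suc n) f ≈ ∑ n f + f (suc n)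
    Ord≥        : ℕ → Carrier → Set
    Ord≥-cong   : ∀ {n x y} → x ≈ y → Ord≥ n x → Ord≥ n y
    Ord≥-0#     : ∀ n → Ord≥ n 0#
    Ord≥-+      : ∀ {n x y} → Ord≥ n x → Ord≥ n y → Ord≥ n (x + y)
    Ord≥--      : ∀ {n x} → Ord≥ n x → Ord≥ n (- x)
    Ord≥-*      : ∀ {m n x y} → Ord≥ m x → Ord≥ n y → Ord≥ (m ℕ.+ n) (x * y)
    Ord≥-zero   : ∀ x → Ord≥ 0 x
    Ord≥-weaken : ∀ {m n x} → m ≤ n → Ord≥ n x → Ord≥ m x

  open FiniteSums commutativeRing ∑ ∑-zero ∑-suc public

  Ord≥-*ˡ : ∀ {n x} y → Ord≥ n x → Ord≥ n (x * y)
  Ord≥-*ˡ y x-small = Ord≥-weaken (ℕₚ.≤-reflexive (≡.sym (ℕₚ.+-identityʳ _))) (Ord≥-* x-small (Ord≥-zero y))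

  Ord≥-*ʳ : ∀ x {n y} → Ord≥ n y → Ord≥ n (x * y)
  Ord≥-*ʳ x y-small = Ord≥-* (Ord≥-zero x) y-small

  Ord≥-∑ : ∀ n {k} {f : ℕ → Carrier} → (∀ i → i ≤ n → Ord≥ k (f i)) → Ord≥ k (∑ n f)
  Ord≥-∑ zero    f-small = Ord≥-cong (sym (∑-zero _)) (f-small 0 z≤n)
  Ord≥-∑ (suc n) f-small = Ord≥-cong (sym (∑-suc n _))
    (Ord≥-+ (Ord≥-∑ n (λ i i≤n → f-small i (ℕₚ.m≤n⇒m≤1+n i≤n))) (f-small (suc n) ℕₚ.≤-refl))

ℤ-Ord≥ : ℕ → ℤ → Set
ℤ-Ord≥ zero    x = ⊤
ℤ-Ord≥ (suc n) x = x ≡ 0ℤ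

ℤ-filteredRing : FilteredRing
ℤ-filteredRing = record
  { commutativeRing = ℤₚ.+-*-commutativeRing
  ; ∑ = sumTo
  ; ∑-zero = λ _ → ≡.refl
  ; ∑-suc = λ _ _ → ≡.refl
  ; Ord≥ = ℤ-Ord≥
  ; Ord≥-cong = subst-small
  ; Ord≥-0# = zero-small
  ; Ord≥-+ = +-small
  ; Ord≥-- = neg-small
  ; Ord≥-* = *-small
  ; Ord≥-zero = λ _ → tt
  ; Ord≥-weaken = weaken
  }
  where
  subst-small : ∀ {n x y} → x ≡ y → ℤ-Ord≥ n x → ℤ-Ord≥ n y
  subst-small {zero}  _      _ = tt
  subst-small {suc n} ≡.refl o = o
  zero-small : ∀ n → ℤ-Ord≥ n 0ℤ
  zero-small zero    = tt
  zero-small (suc n) = ≡.refl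
  +-small : ∀ {n x y} → ℤ-Ord≥ n x → ℤ-Ord≥ n y → ℤ-Ord≥ n (x ℤ.+ y)
  +-small {zero}  _      _      = tt
  +-small {suc n} ≡.refl ≡.refl = ≡.refl
  neg-small : ∀ {n x} → ℤ-Ord≥ n x → ℤ-Ord≥ n (ℤ.- x)
  neg-small {zero}  _      = tt
  neg-small {suc n} ≡.refl = ≡.refl
  *-small : ∀ {m n x y} → ℤ-Ord≥ m x → ℤ-Ord≥ n y → ℤ-Ord≥ (m ℕ.+ n) (x ℤ.* y)
  *-small {zero}  {zero}      _ _      = tt
  *-small {zero}  {suc n} {x} _ ≡.refl = ℤₚ.*-zeroʳ x
  *-small {suc m}             ≡.refl _ = ≡.refl
  weaken : ∀ {m n x} → m ≤ n → ℤ-Ord≥ n x → ℤ-Ord≥ m x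
  weaken {zero}          _ _ = tt
  weaken {suc m} {suc n} _ o = o

[m+n]∸[a+b]≤[m∸a]+[n∸b] : ∀ m n a b → (m ℕ.+ n) ∸ (a ℕ.+ b) ≤ (m ∸ a) ℕ.+ (n ∸ b)
[m+n]∸[a+b]≤[m∸a]+[n∸b] m n a b = ℕₚ.m≤n+o⇒m∸n≤o (m ℕ.+ n) (a ℕ.+ b) (begin
  m ℕ.+ n                             ≤⟨ ℕₚ.+-mono-≤ (ℕₚ.m≤n+m∸n m a) (ℕₚ.m≤n+m∸n n b) ⟩
  (a ℕ.+ (m ∸ a)) ℕ.+ (b ℕ.+ (n ∸ b)) ≡⟨ interchange a (m ∸ a) b (n ∸ b) ⟩
  (a ℕ.+ b) ℕ.+ ((m ∸ a) ℕ.+ (n ∸ b)) ∎)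
  where
  open ℕₚ.≤-Reasoning
  open import Algebra.Properties.CommutativeSemigroup ℕₚ.+-commutativeSemigroup using (interchange)

-- Iterating this construction over ℤ, Ord≥ n f says that f has no monomials
-- of total degree < n.
module PowerSeries (R : FilteredRing) where
  open FilteredRing R
  import Algebra.Construct.Pointwise ℕ as Pointwise
  open import Relation.Binary.Reasoning.Setoid setoid

  Series : Set
  Series = ℕ → Carrier

  _≈ₛ_ : Series → Series → Set
  f ≈ₛ g = ∀ i → f i ≈ g i

  _+ₛ_ _*ₛ_ : Series → Series → Series
  (f +ₛ g) i = f i + g i
  (f *ₛ g) i = ∑ i (λ t → f t * g (i ∸ t))

  -ₛ_ : Series → Series
  (-ₛ f) i = - f i

  0ₛ 1ₛ : Series
  0ₛ _ = 0#
  1ₛ zero    = 1#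
  1ₛ (suc _) = 0#

  *ₛ-cong : ∀ {f f′ g g′} → f ≈ₛ f′ → g ≈ₛ g′ → (f *ₛ g) ≈ₛ (f′ *ₛ g′)
  *ₛ-cong f≈f′ g≈g′ i = ∑-cong i (λ t → *-cong (f≈f′ t) (g≈g′ (i ∸ t)))

  *ₛ-assoc : ∀ f g h → ((f *ₛ g) *ₛ h) ≈ₛ (f *ₛ (g *ₛ h))
  *ₛ-assoc f g h n = begin
    ∑ n (λ s → ∑ s (λ i → f i * g (s ∸ i)) * h (n ∸ s))
      ≈⟨ ∑-cong n (λ s → *-distribʳ-∑ s _ _) ⟩
    ∑ n (λ s → ∑ s (λ i → (f i * g (s ∸ i)) * h (n ∸ s)))
      ≈⟨ ∑-triangle n (λ i s → (f i * g (s ∸ i)) * h (n ∸ s)) ⟨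
    ∑ n (λ i → ∑ (n ∸ i) (λ t → (f i * g ((i ℕ.+ t) ∸ i)) * h (n ∸ (i ℕ.+ t))))
      ≈⟨ ∑-cong n (λ i → ∑-cong (n ∸ i) (λ t → trans (*-assoc _ _ _)
           (*-congˡ (*-cong (≡⇒≈ (≡.cong g (ℕₚ.m+n∸m≡n i t)))
                            (≡⇒≈ (≡.cong h (≡.sym (ℕₚ.∸-+-assoc n i t)))))))) ⟩
    ∑ n (λ i → ∑ (n ∸ i) (λ t → f i * (g t * h ((n ∸ i) ∸ t))))
      ≈⟨ ∑-cong n (λ i → *-distribˡ-∑ (n ∸ i) (f i) _) ⟨
    ∑ n (λ i → f i * ∑ (n ∸ i) (λ t → g t * h ((n ∸ i) ∸ t))) ∎

  *ₛ-comm : ∀ f g → (f *ₛ g) ≈ₛ (g *ₛ f)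
  *ₛ-comm f g n = begin
    ∑ n (λ t → f t * g (n ∸ t))                 ≈⟨ ∑-reverse n _ ⟩
    ∑ n (λ t → f (n ∸ t) * g (n ∸ (n ∸ t)))     ≈⟨ ∑-cong≤ n (λ t t≤n → trans (*-comm _ _)
                                                     (*-congʳ (≡⇒≈ (≡.cong g (ℕₚ.m∸[m∸n]≡n t≤n))))) ⟩
    ∑ n (λ t → g t * f (n ∸ t))                 ∎

  *ₛ-identityˡ : ∀ f → (1ₛ *ₛ f) ≈ₛ f
  *ₛ-identityˡ f zero    = trans (∑-zero _) (*-identityˡ _)
  *ₛ-identityˡ f (suc n) = begin
    ∑ (suc n) (λ t → 1ₛ t * f (suc n ∸ t))      ≈⟨ ∑-head n _ ⟩
    1# * f (suc n) + ∑ n (λ i → 0# * f (n ∸ i)) ≈⟨ +-cong (*-identityˡ _) (∑-vanishes n (λ i _ → zeroˡ _)) ⟩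
    f (suc n) + 0#                              ≈⟨ +-identityʳ _ ⟩
    f (suc n)                                   ∎

  *ₛ-distribˡ : ∀ f g h → (f *ₛ (g +ₛ h)) ≈ₛ ((f *ₛ g) +ₛ (f *ₛ h))
  *ₛ-distribˡ f g h n = trans (∑-cong n (λ t → distribˡ _ _ _)) (∑-+ n _ _)

  *ₛ-distribʳ : ∀ f g h → ((g +ₛ h) *ₛ f) ≈ₛ ((g *ₛ f) +ₛ (h *ₛ f))
  *ₛ-distribʳ f g h n = trans (∑-cong n (λ t → distribʳ _ _ _)) (∑-+ n _ _)

  series-isCommutativeRing : IsCommutativeRing _≈ₛ_ _+ₛ_ _*ₛ_ -ₛ_ 0ₛ 1ₛ
  series-isCommutativeRing = record
    { isRing = record
      { +-isAbelianGroup = Pointwise.isAbelianGroup +-isAbelianGroup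
      ; *-cong = *ₛ-cong
      ; *-assoc = *ₛ-assoc
      ; *-identity = *ₛ-identityˡ , λ f n → trans (*ₛ-comm f 1ₛ n) (*ₛ-identityˡ f n)
      ; distrib = *ₛ-distribˡ , *ₛ-distribʳ
      }
    ; *-comm = *ₛ-comm
    }

  Ord≥ₛ : ℕ → Series → Set
  Ord≥ₛ n f = ∀ i → Ord≥ (n ∸ i) (f i)

  Ord≥ₛ-* : ∀ {m n f g} → Ord≥ₛ m f → Ord≥ₛ n g → Ord≥ₛ (m ℕ.+ n) (f *ₛ g)
  Ord≥ₛ-* {m} {n} f-small g-small i = Ord≥-∑ i (λ t t≤i →
    Ord≥-weaken (order-bound t≤i) (Ord≥-* (f-small t) (g-small (i ∸ t))))
    where
    order-bound : ∀ {t} → t ≤ i → (m ℕ.+ n) ∸ i ≤ (m ∸ t) ℕ.+ (n ∸ (i ∸ t))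
    order-bound {t} t≤i = ≡.subst (λ k → (m ℕ.+ n) ∸ k ≤ (m ∸ t) ℕ.+ (n ∸ (i ∸ t))) (ℕₚ.m+[n∸m]≡n t≤i)
                            ([m+n]∸[a+b]≤[m∸a]+[n∸b] m n t (i ∸ t))

  filteredRing : FilteredRing
  filteredRing = record
    { commutativeRing = record { isCommutativeRing = series-isCommutativeRing }
    ; ∑ = λ n F i → ∑ n (λ t → F t i)
    ; ∑-zero = λ F i → ∑-zero _
    ; ∑-suc = λ n F i → ∑-suc n _
    ; Ord≥ = Ord≥ₛ
    ; Ord≥-cong = λ f≈g f-small i → Ord≥-cong (f≈g i) (f-small i)
    ; Ord≥-0# = λ n i → Ord≥-0# _
    ; Ord≥-+ = λ f-small g-small i → Ord≥-+ (f-small i) (g-small i)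
    ; Ord≥-- = λ f-small i → Ord≥-- (f-small i)
    ; Ord≥-* = Ord≥ₛ-*
    ; Ord≥-zero = λ f i → Ord≥-weaken (ℕₚ.m∸n≤m 0 i) (Ord≥-zero (f i))
    ; Ord≥-weaken = λ m≤n f-small i → Ord≥-weaken (ℕₚ.∸-monoˡ-≤ i m≤n) (f-small i)
    }

-- Series in q, a, b, c, z (outermost variable q), matching PS and _⊛_ of Defs.
-- Written out in full: with a local abbreviation for PowerSeries.filteredRing,
-- conversion checks against the q-series operations below become very slow.
Series⁵ : FilteredRing
Series⁵ = PowerSeries.filteredRing (PowerSeries.filteredRing (PowerSeries.filteredRing
            (PowerSeries.filteredRing (PowerSeries.filteredRing ℤ-filteredRing))))

-- The quotient of R by the elements of order > D, as a ring on the same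
-- carrier with a coarser equality.
module Truncation (R : FilteredRing) (D : ℕ) where
  open FilteredRing R
  open import Algebra.Properties.Ring ring using (-0#≈0#)
  open DifferenceIdentities commutativeRing

  infix 4 _≋_
  record _≋_ (x y : Carrier) : Set where
    constructor mk≋
    field small-difference : Ord≥ (suc D) (x - y)
  open _≋_ public

  small⇒≋0# : ∀ {x} → Ord≥ (suc D) x → x ≋ 0#
  small⇒≋0# x-small = mk≋ (Ord≥-cong (sym (trans (+-congˡ -0#≈0#) (+-identityʳ _))) x-small)

  ≈⇒≋ : ∀ {x y} → x ≈ y → x ≋ y
  ≈⇒≋ {x} {y} x≈y = mk≋ (Ord≥-cong (sym (trans (+-congʳ x≈y) (-‿inverseʳ y))) (Ord≥-0# _))

  ≋-refl : ∀ {x} → x ≋ x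
  ≋-refl = ≈⇒≋ refl

  ≋-sym : ∀ {x y} → x ≋ y → y ≋ x
  ≋-sym {x} {y} (mk≋ x-y) = mk≋ (Ord≥-cong (sym (y-x≈-[x-y] x y)) (Ord≥-- x-y))

  ≋-trans : ∀ {x y z} → x ≋ y → y ≋ z → x ≋ z
  ≋-trans {x} {y} {z} (mk≋ x-y) (mk≋ y-z) = mk≋ (Ord≥-cong (sym (x-z≈[x-y]+[y-z] x y z)) (Ord≥-+ x-y y-z))

  +-cong≋ : ∀ {x y u v} → x ≋ y → u ≋ v → x + u ≋ y + v
  +-cong≋ {x} {y} {u} {v} (mk≋ x-y) (mk≋ u-v) = mk≋ (Ord≥-cong (sym ([x+u]-[y+v]≈[x-y]+[u-v] x u y v)) (Ord≥-+ x-y u-v))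

  -‿cong≋ : ∀ {x y} → x ≋ y → - x ≋ - y
  -‿cong≋ {x} {y} (mk≋ x-y) = mk≋ (Ord≥-cong (sym ([-x]-[-y]≈-[x-y] x y)) (Ord≥-- x-y))

  *-cong≋ : ∀ {x y u v} → x ≋ y → u ≋ v → x * u ≋ y * v
  *-cong≋ {x} {y} {u} {v} (mk≋ x-y) (mk≋ u-v) = mk≋ (Ord≥-cong (sym (xu-yv≈[x-y]u+y[u-v] x u y v))
    (Ord≥-+ (Ord≥-*ˡ u x-y) (Ord≥-*ʳ y u-v)))

  truncated-isCommutativeRing : IsCommutativeRing _≋_ _+_ _*_ -_ 0# 1#
  truncated-isCommutativeRing = record
    { isRing = record
      { +-isAbelianGroup = record
        { isGroup = record
          { isMonoid = record
            { isSemigroup = record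
              { isMagma = record
                { isEquivalence = record { refl = ≋-refl ; sym = ≋-sym ; trans = ≋-trans }
                ; ∙-cong = +-cong≋
                }
              ; assoc = λ x y z → ≈⇒≋ (+-assoc x y z)
              }
            ; identity = (λ x → ≈⇒≋ (+-identityˡ x)) , (λ x → ≈⇒≋ (+-identityʳ x))
            }
          ; inverse = (λ x → ≈⇒≋ (-‿inverseˡ x)) , (λ x → ≈⇒≋ (-‿inverseʳ x))
          ; ⁻¹-cong = -‿cong≋
          }
        ; comm = λ x y → ≈⇒≋ (+-comm x y)
        }
      ; *-cong = *-cong≋
      ; *-assoc = λ x y z → ≈⇒≋ (*-assoc x y z)
      ; *-identity = (λ x → ≈⇒≋ (*-identityˡ x)) , (λ x → ≈⇒≋ (*-identityʳ x))
      ; distrib = (λ x y z → ≈⇒≋ (distribˡ x y z)) , (λ x y z → ≈⇒≋ (distribʳ x y z))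
      }
    ; *-comm = λ x y → ≈⇒≋ (*-comm x y)
    }

  truncatedRing : CommutativeRing 0ℓ 0ℓ
  truncatedRing = record { isCommutativeRing = truncated-isCommutativeRing }

module QSeries (R : FilteredRing) (D : ℕ)
  (q : FilteredRing.Carrier R) (q-small : FilteredRing.Ord≥ R 1 q) where

  module E = FilteredRing R
  open E using (Carrier; ∑; Ord≥; Ord≥-cong; Ord≥-0#; Ord≥-+; Ord≥--; Ord≥-*; Ord≥-*ˡ; Ord≥-*ʳ;
                Ord≥-zero; Ord≥-weaken; Ord≥-∑)
  module Eᵢ = DifferenceIdentities E.commutativeRing
  open Truncation R D using (_≋_; mk≋; ≈⇒≋; small⇒≋0#; truncatedRing)
  open CommutativeRing truncatedRing public hiding (Carrier)
  open import Relation.Binary.Reasoning.Setoid setoid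
  open import Algebra.Properties.CommutativeSemiring.Exp commutativeSemiring public
    using (_^_; ^-congˡ; ^-homo-*; ^-assocʳ; ^-distrib-*)
  open import Algebra.Properties.Ring ring using (-0#≈0#)
  open import Algebra.Properties.CommutativeSemigroup *-commutativeSemigroup
    using (interchange; x∙yz≈y∙xz)
  open IntegerRingSolver truncatedRing using (solve; _:=_; _:+_; _:*_; :-_; _:-_; con)

  ∑-zero : ∀ f → ∑ 0 f ≈ f 0
  ∑-zero f = ≈⇒≋ (E.∑-zero f)

  ∑-suc : ∀ n f → ∑ (suc n) f ≈ ∑ n f + f (suc n)
  ∑-suc n f = ≈⇒≋ (E.∑-suc n f)

  open FiniteSums truncatedRing ∑ ∑-zero ∑-suc public

  Ord≥-^ : ∀ {k x} n → Ord≥ k x → Ord≥ (n ℕ.* k) (x ^ n)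
  Ord≥-^ zero    _       = Ord≥-zero _
  Ord≥-^ (suc n) x-small = Ord≥-* x-small (Ord≥-^ n x-small)

  Ord≥-^₁ : ∀ {x} n → Ord≥ 1 x → Ord≥ n (x ^ n)
  Ord≥-^₁ n x-small = Ord≥-weaken (ℕₚ.≤-reflexive (≡.sym (ℕₚ.*-identityʳ n))) (Ord≥-^ n x-small)

  Ord≥-*q^ : ∀ {x} → Ord≥ 1 x → ∀ k → Ord≥ (suc k) (x * q ^ k)
  Ord≥-*q^ x-small k = Ord≥-* x-small (Ord≥-^₁ k q-small)

  ∏< : ℕ → (ℕ → Carrier) → Carrier
  ∏< zero    f = 1#
  ∏< (suc n) f = ∏< n f * f n

  ∏<-cong≤ : ∀ n {f g : ℕ → Carrier} → (∀ k → k < n → f k ≈ g k) → ∏< n f ≈ ∏< n g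
  ∏<-cong≤ zero    f≈g = refl
  ∏<-cong≤ (suc n) f≈g = *-cong (∏<-cong≤ n (λ k k<n → f≈g k (ℕₚ.m≤n⇒m≤1+n k<n))) (f≈g n ℕₚ.≤-refl)

  ∏<-cong : ∀ n {f g : ℕ → Carrier} → (∀ k → f k ≈ g k) → ∏< n f ≈ ∏< n g
  ∏<-cong n f≈g = ∏<-cong≤ n (λ k _ → f≈g k)

  ∏<-1# : ∀ n {f : ℕ → Carrier} → (∀ k → f k ≈ 1#) → ∏< n f ≈ 1#
  ∏<-1# zero    f≈1 = refl
  ∏<-1# (suc n) f≈1 = trans (*-cong (∏<-1# n f≈1) (f≈1 n)) (*-identityˡ 1#)

  ∏<-inverse : ∀ n {f g : ℕ → Carrier} → (∀ k → f k * g k ≈ 1#) → ∏< n f * ∏< n g ≈ 1#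
  ∏<-inverse zero    fg≈1 = *-identityˡ 1#
  ∏<-inverse (suc n) fg≈1 = begin
    (∏< n _ * _) * (∏< n _ * _) ≈⟨ interchange _ _ _ _ ⟩
    (∏< n _ * ∏< n _) * (_ * _) ≈⟨ *-cong (∏<-inverse n fg≈1) (fg≈1 n) ⟩
    1# * 1#                     ≈⟨ *-identityˡ 1# ⟩
    1#                          ∎

  ∏<-split : ∀ m n (f : ℕ → Carrier) → ∏< (m ℕ.+ n) f ≈ ∏< m f * ∏< n (λ j → f (m ℕ.+ j))
  ∏<-split m zero    f = begin
    ∏< (m ℕ.+ 0) f ≡⟨ ≡.cong (λ k → ∏< k f) (ℕₚ.+-identityʳ m) ⟩
    ∏< m f         ≈⟨ *-identityʳ _ ⟨
    ∏< m f * 1#    ∎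
  ∏<-split m (suc n) f = begin
    ∏< (m ℕ.+ suc n) f                                ≡⟨ ≡.cong (λ k → ∏< k f) (ℕₚ.+-suc m n) ⟩
    ∏< (m ℕ.+ n) f * f (m ℕ.+ n)                      ≈⟨ *-congʳ (∏<-split m n f) ⟩
    (∏< m f * ∏< n (λ j → f (m ℕ.+ j))) * f (m ℕ.+ n) ≈⟨ *-assoc _ _ _ ⟩
    ∏< m f * ∏< (suc n) (λ j → f (m ℕ.+ j))           ∎

  ∏<-stable : ∀ {f : ℕ → Carrier} → (∀ k → Ord≥ (suc k) (f k E.- E.1#)) →
              ∀ t n → Ord≥ n (∏< (t ℕ.+ n) f E.- ∏< n f)
  ∏<-stable     f-near-1 zero    n = Ord≥-cong (E.sym (E.-‿inverseʳ _)) (Ord≥-0# n)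
  ∏<-stable {f} f-near-1 (suc t) n = Ord≥-cong (E.sym (Eᵢ.xy-z≈x[y-1]+[x-z] (∏< (t ℕ.+ n) f) (f (t ℕ.+ n)) (∏< n f)))
    (Ord≥-+ (Ord≥-weaken (ℕₚ.m≤n+m n (suc t)) (Ord≥-*ʳ _ (f-near-1 (t ℕ.+ n))))
            (∏<-stable f-near-1 t n))

  ∏<-stable≈ : ∀ {f : ℕ → Carrier} → (∀ k → Ord≥ (suc k) (f k E.- E.1#)) →
               ∀ t → ∏< (t ℕ.+ suc D) f ≈ ∏< (suc D) f
  ∏<-stable≈ f-near-1 t = mk≋ (∏<-stable f-near-1 t (suc D))

  1-0≈1 : 1# - 0# ≈ 1#
  1-0≈1 = trans (+-congˡ -0#≈0#) (+-identityʳ 1#)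

  geom : Carrier → Carrier
  geom y = ∑ D (y ^_)

  geom-cong : ∀ {y y′} → y ≈ y′ → geom y ≈ geom y′
  geom-cong y≈y′ = ∑-cong D (λ n → ^-congˡ n y≈y′)

  ∑^-telescope : ∀ N y → ∑ N (y ^_) * (1# - y) ≈ 1# - y ^ suc N
  ∑^-telescope zero y = begin
    ∑ 0 (y ^_) * (1# - y) ≈⟨ *-congʳ (∑-zero _) ⟩
    1# * (1# - y)         ≈⟨ *-identityˡ _ ⟩
    1# - y                ≈⟨ +-congˡ (-‿cong (*-identityʳ y)) ⟨
    1# - y ^ 1            ∎
  ∑^-telescope (suc N) y = begin
    ∑ (suc N) (y ^_) * (1# - y)              ≈⟨ *-congʳ (∑-suc N _) ⟩
    (S + P) * (1# - y)
      ≈⟨ solve 3 (λ S P y → (S :+ P) :* (con (+ 1) :- y) := S :* (con (+ 1) :- y) :+ (P :- y :* P)) refl S P y ⟩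
    S * (1# - y) + (P - y * P)
      ≈⟨ +-congʳ (∑^-telescope N y) ⟩
    (1# - P) + (P - y * P)
      ≈⟨ solve 2 (λ P y → (con (+ 1) :- P) :+ (P :- y :* P) := con (+ 1) :- y :* P) refl P y ⟩
    1# - y ^ suc (suc N) ∎
    where
    S = ∑ N (y ^_)
    P = y ^ suc N

  geom-inverse : ∀ {y} → Ord≥ 1 y → geom y * (1# - y) ≈ 1#
  geom-inverse {y} y-small = begin
    geom y * (1# - y) ≈⟨ ∑^-telescope D y ⟩
    1# - y ^ suc D    ≈⟨ +-congˡ (-‿cong (small⇒≋0# (Ord≥-^₁ (suc D) y-small))) ⟩
    1# - 0#           ≈⟨ 1-0≈1 ⟩
    1#                ∎

  Ord≥-∑-tail : ∀ {s y} → Ord≥ s y → 1 ≤ s → ∀ N (g : ℕ → Carrier) →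
                Ord≥ s (∑ N (λ n → g n E.* y ^ n) E.- g 0)
  Ord≥-∑-tail {s} {y} y-small 1≤s zero g = Ord≥-cong (E.sym tail≈0) (Ord≥-0# s)
    where
    tail≈0 : ∑ 0 (λ n → g n E.* y ^ n) E.- g 0 E.≈ E.0#
    tail≈0 = E.trans (E.+-congʳ (E.trans (E.∑-zero _) (E.*-identityʳ _))) (E.-‿inverseʳ _)
  Ord≥-∑-tail {s} {y} y-small 1≤s (suc N) g = Ord≥-cong (E.sym split)
    (Ord≥-+ (Ord≥-∑-tail y-small 1≤s N g)
            (Ord≥-*ʳ (g (suc N)) (Ord≥-weaken (ℕₚ.m≤m+n s (N ℕ.* s)) (Ord≥-^ (suc N) y-small))))
    where
    S = ∑ N (λ n → g n E.* y ^ n)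
    T = g (suc N) E.* y ^ suc N
    split : ∑ (suc N) (λ n → g n E.* y ^ n) E.- g 0 E.≈ (S E.- g 0) E.+ T
    split = E.trans (E.+-congʳ (E.∑-suc N _)) (Eᵢ.[x+y]-z≈[x-z]+y S T (g 0))

  poch-factor invPoch-factor : Carrier → ℕ → Carrier
  poch-factor    x k = 1# - x * q ^ k
  invPoch-factor x k = geom (x * q ^ k)

  poch invPoch : Carrier → ℕ → Carrier
  poch    x n = ∏< n (poch-factor x)
  invPoch x n = ∏< n (invPoch-factor x)

  invQQ : ℕ → Carrier
  invQQ = invPoch q

  -- Modulo order > D the factors of index > D are 1 (∏<-stable≈), so the
  -- infinite products are represented by their first D + 1 factors.
  poch∞ invPoch∞ : Carrier → Carrier
  poch∞    x = poch x (suc D)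
  invPoch∞ x = invPoch x (suc D)

  poch-factor-near-1 : ∀ {x} → Ord≥ 1 x → ∀ k → Ord≥ (suc k) (poch-factor x k E.- 1#)
  poch-factor-near-1 x-small k = Ord≥-cong (E.sym (Eᵢ.[1-x]-1≈-x _)) (Ord≥-- (Ord≥-*q^ x-small k))

  invPoch-factor-near-1 : ∀ {x} → Ord≥ 1 x → ∀ k → Ord≥ (suc k) (invPoch-factor x k E.- 1#)
  invPoch-factor-near-1 x-small k = Ord≥-cong (E.+-congʳ (E.∑-cong D (λ n → E.*-identityˡ _)))
    (Ord≥-∑-tail (Ord≥-*q^ x-small k) (s≤s z≤n) D (λ _ → 1#))

  poch-cong : ∀ {x y} n → x ≈ y → poch x n ≈ poch y n
  poch-cong n x≈y = ∏<-cong n (λ k → +-congˡ (-‿cong (*-congʳ x≈y)))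

  invPoch-cong : ∀ {x y} n → x ≈ y → invPoch x n ≈ invPoch y n
  invPoch-cong n x≈y = ∏<-cong n (λ k → geom-cong (*-congʳ x≈y))

  poch*invPoch : ∀ {x} → Ord≥ 1 x → ∀ n → poch x n * invPoch x n ≈ 1#
  poch*invPoch x-small n = ∏<-inverse n (λ k → trans (*-comm _ _) (geom-inverse (Ord≥-*ˡ _ x-small)))

  invPoch*poch : ∀ {x} → Ord≥ 1 x → ∀ n → invPoch x n * poch x n ≈ 1#
  invPoch*poch x-small n = trans (*-comm _ _) (poch*invPoch x-small n)

  *q^-+ : ∀ x m j → x * q ^ (m ℕ.+ j) ≈ (x * q ^ m) * q ^ j
  *q^-+ x m j = trans (*-congˡ (^-homo-* q m j)) (sym (*-assoc _ _ _))

  poch-split : ∀ x m n → poch x (m ℕ.+ n) ≈ poch x m * poch (x * q ^ m) n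
  poch-split x m n = trans (∏<-split m n _) (*-congˡ (∏<-cong n (λ j → +-congˡ (-‿cong (*q^-+ x m j)))))

  invPoch-split : ∀ x m n → invPoch x (m ℕ.+ n) ≈ invPoch x m * invPoch (x * q ^ m) n
  invPoch-split x m n = trans (∏<-split m n _) (*-congˡ (∏<-cong n (λ j → geom-cong (*q^-+ x m j))))

  poch∞-shift : ∀ {x} → Ord≥ 1 x → ∀ j → poch∞ (x * q ^ j) ≈ invPoch x j * poch∞ x
  poch∞-shift {x} x-small j = begin
    poch∞ (x * q ^ j)                            ≈⟨ *-identityˡ _ ⟨
    1# * poch∞ (x * q ^ j)                       ≈⟨ *-congʳ (invPoch*poch x-small j) ⟨
    (invPoch x j * poch x j) * poch∞ (x * q ^ j) ≈⟨ *-assoc _ _ _ ⟩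
    invPoch x j * (poch x j * poch∞ (x * q ^ j)) ≈⟨ *-congˡ (poch-split x j (suc D)) ⟨
    invPoch x j * poch x (j ℕ.+ suc D)           ≈⟨ *-congˡ (∏<-stable≈ (poch-factor-near-1 x-small) j) ⟩
    invPoch x j * poch∞ x                        ∎

  invPoch∞-shift : ∀ {x} → Ord≥ 1 x → ∀ j → invPoch∞ (x * q ^ j) ≈ poch x j * invPoch∞ x
  invPoch∞-shift {x} x-small j = begin
    invPoch∞ (x * q ^ j)                            ≈⟨ *-identityˡ _ ⟨
    1# * invPoch∞ (x * q ^ j)                       ≈⟨ *-congʳ (poch*invPoch x-small j) ⟨
    (poch x j * invPoch x j) * invPoch∞ (x * q ^ j) ≈⟨ *-assoc _ _ _ ⟩
    poch x j * (invPoch x j * invPoch∞ (x * q ^ j)) ≈⟨ *-congˡ (invPoch-split x j (suc D)) ⟨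
    poch x j * invPoch x (j ℕ.+ suc D)              ≈⟨ *-congˡ (∏<-stable≈ (invPoch-factor-near-1 x-small) j) ⟩
    poch x j * invPoch∞ x                           ∎

  poch≈poch∞/poch∞ : ∀ {x} → Ord≥ 1 x → ∀ n → poch x n ≈ poch∞ x * invPoch∞ (x * q ^ n)
  poch≈poch∞/poch∞ {x} x-small n = begin
    poch x n                                              ≈⟨ *-identityʳ _ ⟨
    poch x n * 1#                                         ≈⟨ *-congˡ (poch*invPoch (Ord≥-*ˡ _ x-small) (suc D)) ⟨
    poch x n * (poch∞ (x * q ^ n) * invPoch∞ (x * q ^ n)) ≈⟨ *-assoc _ _ _ ⟨
    (poch x n * poch∞ (x * q ^ n)) * invPoch∞ (x * q ^ n) ≈⟨ *-congʳ (poch-split x n (suc D)) ⟨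
    poch x (n ℕ.+ suc D) * invPoch∞ (x * q ^ n)           ≈⟨ *-congʳ (∏<-stable≈ (poch-factor-near-1 x-small) n) ⟩
    poch∞ x * invPoch∞ (x * q ^ n)                        ∎

  ₁φ₀ : Carrier → Carrier → Carrier
  ₁φ₀ α x = ∑ D (λ n → poch α n * invQQ n * x ^ n)

  ₁φ₀-cong : ∀ α {x y} → x ≈ y → ₁φ₀ α x ≈ ₁φ₀ α y
  ₁φ₀-cong α x≈y = ∑-cong D (λ n → *-congˡ (^-congˡ n x≈y))

  module _ (α : Carrier) where

    private
      coeff : ℕ → Carrier
      coeff n = poch α n * invQQ n

      term : Carrier → ℕ → Carrier
      term x n = coeff n * (1# - α * q ^ n) * x ^ suc n

      coeff-recurrence : ∀ m → coeff (suc m) * (1# - q ^ suc m) ≈ coeff m * (1# - α * q ^ m)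
      coeff-recurrence m = begin
        ((P * U) * (I * G)) * V    ≈⟨ solve 5 (λ P U I G V → ((P :* U) :* (I :* G)) :* V := (P :* I) :* U :* (G :* V)) refl P U I G V ⟩
        (P * I) * U * (G * V)      ≈⟨ *-congˡ (geom-inverse (Ord≥-*ˡ _ q-small)) ⟩
        (P * I) * U * 1#           ≈⟨ *-identityʳ _ ⟩
        coeff m * (1# - α * q ^ m) ∎
        where
        P = poch α m
        U = 1# - α * q ^ m
        I = invQQ m
        G = geom (q * q ^ m)
        V = 1# - q ^ suc m

      telescope : ∀ x N → ∑ N (λ n → coeff n * (1# - q ^ n) * x ^ n) ≈ ∑ N (term x) - term x N
      telescope x zero = begin
        ∑ 0 (λ n → coeff n * (1# - q ^ n) * x ^ n)   ≈⟨ ∑-zero _ ⟩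
        coeff 0 * (1# - 1#) * 1#
          ≈⟨ solve 1 (λ C → C :* (con (+ 1) :- con (+ 1)) :* con (+ 1) := con (+ 0)) refl (coeff 0) ⟩
        0#                                           ≈⟨ -‿inverseʳ _ ⟨
        term x 0 - term x 0                          ≈⟨ +-congʳ (∑-zero _) ⟨
        ∑ 0 (term x) - term x 0                      ∎
      telescope x (suc N) = begin
        ∑ (suc N) (λ n → coeff n * (1# - q ^ n) * x ^ n)                        ≈⟨ ∑-suc N _ ⟩
        ∑ N (λ n → coeff n * (1# - q ^ n) * x ^ n) + coeff (suc N) * (1# - q ^ suc N) * x ^ suc N
                                                    ≈⟨ +-cong (telescope x N) (*-congʳ (coeff-recurrence N)) ⟩
        (S - term x N) + term x N
          ≈⟨ solve 3 (λ S T U → (S :- T) :+ T := (S :+ U) :- U) refl S (term x N) (term x (suc N)) ⟩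
        (S + term x (suc N)) - term x (suc N)       ≈⟨ +-congʳ (∑-suc N _) ⟨
        ∑ (suc N) (term x) - term x (suc N)         ∎
        where
        S = ∑ N (term x)

    ₁φ₀-functional : ∀ {x} → Ord≥ 1 x → ₁φ₀ α x * (1# - x) ≈ (1# - α * x) * ₁φ₀ α (q * x)
    ₁φ₀-functional {x} x-small = begin
      F * (1# - x)
        ≈⟨ solve 4 (λ F G x α → F :* (con (+ 1) :- x) := (con (+ 1) :- α :* x) :* G :+ ((F :- G) :- x :* (F :- α :* G)))
                   refl F G x α ⟩
      (1# - α * x) * G + ((F - G) - x * (F - α * G))  ≈⟨ +-congˡ (+-cong Δ₁ (-‿cong Δ₂)) ⟩
      (1# - α * x) * G + ((S - term x D) - S)         ≈⟨ +-congˡ (+-congʳ (+-congˡ (-‿cong last-term≈0))) ⟩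
      (1# - α * x) * G + ((S - 0#) - S)               ≈⟨ +-congˡ (solve 1 (λ S → (S :- con (+ 0)) :- S := con (+ 0)) refl S) ⟩
      (1# - α * x) * G + 0#                           ≈⟨ +-identityʳ _ ⟩
      (1# - α * x) * G                                ∎
      where
      F = ₁φ₀ α x
      G = ₁φ₀ α (q * x)
      S = ∑ D (term x)

      last-term≈0 : term x D ≈ 0#
      last-term≈0 = small⇒≋0# (Ord≥-*ʳ _ (Ord≥-^₁ (suc D) x-small))

      Δ₁ : F - G ≈ S - term x D
      Δ₁ = begin
        F - G                                               ≈⟨ ∑-- D _ _ ⟨
        ∑ D (λ n → coeff n * x ^ n - coeff n * (q * x) ^ n) ≈⟨ ∑-cong D per-term ⟩
        ∑ D (λ n → coeff n * (1# - q ^ n) * x ^ n)          ≈⟨ telescope x D ⟩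
        S - term x D                                        ∎
        where
        per-term : ∀ n → coeff n * x ^ n - coeff n * (q * x) ^ n ≈ coeff n * (1# - q ^ n) * x ^ n
        per-term n = begin
          coeff n * x ^ n - coeff n * (q * x) ^ n        ≈⟨ +-congˡ (-‿cong (*-congˡ (^-distrib-* q x n))) ⟩
          coeff n * x ^ n - coeff n * (q ^ n * x ^ n)
            ≈⟨ solve 3 (λ C X Q → C :* X :- C :* (Q :* X) := C :* (con (+ 1) :- Q) :* X) refl (coeff n) (x ^ n) (q ^ n) ⟩
          coeff n * (1# - q ^ n) * x ^ n                 ∎

      Δ₂ : x * (F - α * G) ≈ S
      Δ₂ = begin
        x * (F - α * G)                                                 ≈⟨ *-congˡ (+-congˡ (-‿cong (*-distribˡ-∑ D α _))) ⟩
        x * (F - ∑ D (λ n → α * (coeff n * (q * x) ^ n)))               ≈⟨ *-congˡ (∑-- D _ _) ⟨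
        x * ∑ D (λ n → coeff n * x ^ n - α * (coeff n * (q * x) ^ n))   ≈⟨ *-distribˡ-∑ D x _ ⟩
        ∑ D (λ n → x * (coeff n * x ^ n - α * (coeff n * (q * x) ^ n))) ≈⟨ ∑-cong D per-term ⟩
        S                                                               ∎
        where
        per-term : ∀ n → x * (coeff n * x ^ n - α * (coeff n * (q * x) ^ n)) ≈ term x n
        per-term n = begin
          x * (coeff n * x ^ n - α * (coeff n * (q * x) ^ n))
            ≈⟨ *-congˡ (+-congˡ (-‿cong (*-congˡ (*-congˡ (^-distrib-* q x n))))) ⟩
          x * (coeff n * x ^ n - α * (coeff n * (q ^ n * x ^ n)))
            ≈⟨ solve 5 (λ x C X α Q → x :* (C :* X :- α :* (C :* (Q :* X))) := C :* (con (+ 1) :- α :* Q) :* (x :* X))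
                       refl x (coeff n) (x ^ n) α (q ^ n) ⟩
          term x n ∎

    ₁φ₀-iterate : ∀ {x} → Ord≥ 1 x → ∀ m → ₁φ₀ α x * poch x m ≈ poch (α * x) m * ₁φ₀ α (q ^ m * x)
    ₁φ₀-iterate {x} x-small zero = begin
      ₁φ₀ α x * 1#        ≈⟨ *-identityʳ _ ⟩
      ₁φ₀ α x             ≈⟨ ₁φ₀-cong α (*-identityˡ x) ⟨
      ₁φ₀ α (1# * x)      ≈⟨ *-identityˡ _ ⟨
      1# * ₁φ₀ α (1# * x) ∎
    ₁φ₀-iterate {x} x-small (suc m) = begin
      ₁φ₀ α x * (poch x m * (1# - x * q ^ m))                 ≈⟨ *-assoc _ _ _ ⟨
      (₁φ₀ α x * poch x m) * (1# - x * q ^ m)                 ≈⟨ *-cong (₁φ₀-iterate x-small m) (+-congˡ (-‿cong (*-comm x _))) ⟩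
      (poch (α * x) m * ₁φ₀ α y) * (1# - y)                   ≈⟨ *-assoc _ _ _ ⟩
      poch (α * x) m * (₁φ₀ α y * (1# - y))                   ≈⟨ *-congˡ (₁φ₀-functional (Ord≥-*ʳ (q ^ m) x-small)) ⟩
      poch (α * x) m * ((1# - α * y) * ₁φ₀ α (q * y))         ≈⟨ *-assoc _ _ _ ⟨
      (poch (α * x) m * (1# - α * y)) * ₁φ₀ α (q * y)
        ≈⟨ *-cong (*-congˡ (+-congˡ (-‿cong αy≈αx*q^m))) (₁φ₀-cong α (*-assoc _ _ _)) ⟨
      poch (α * x) (suc m) * ₁φ₀ α (q ^ suc m * x)            ∎
      where
      y = q ^ m * x
      αy≈αx*q^m : (α * x) * q ^ m ≈ α * y
      αy≈αx*q^m = solve 3 (λ α Q x → (α :* x) :* Q := α :* (Q :* x)) refl α (q ^ m) x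

    ₁φ₀-of-small : ∀ {y} → Ord≥ (suc D) y → ₁φ₀ α y ≈ 1#
    ₁φ₀-of-small y-small = trans (mk≋ (Ord≥-∑-tail y-small (s≤s z≤n) D coeff)) (*-identityˡ 1#)

    q-binomial-theorem : ∀ {x} → Ord≥ 1 x → ₁φ₀ α x ≈ poch∞ (α * x) * invPoch∞ x
    q-binomial-theorem {x} x-small = begin
      ₁φ₀ α x                                              ≈⟨ *-identityʳ _ ⟨
      ₁φ₀ α x * 1#                                         ≈⟨ *-congˡ (poch*invPoch x-small (suc D)) ⟨
      ₁φ₀ α x * (poch∞ x * invPoch∞ x)                     ≈⟨ *-assoc _ _ _ ⟨
      (₁φ₀ α x * poch∞ x) * invPoch∞ x                     ≈⟨ *-congʳ (₁φ₀-iterate x-small (suc D)) ⟩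
      (poch∞ (α * x) * ₁φ₀ α (q ^ suc D * x)) * invPoch∞ x ≈⟨ *-congʳ (*-congˡ (₁φ₀-of-small q^Mx-small)) ⟩
      (poch∞ (α * x) * 1#) * invPoch∞ x                    ≈⟨ *-congʳ (*-identityʳ _) ⟩
      poch∞ (α * x) * invPoch∞ x                           ∎
      where
      q^Mx-small : Ord≥ (suc D) (q ^ suc D * x)
      q^Mx-small = Ord≥-weaken (ℕₚ.m≤m+n (suc D) _) (Ord≥-* (Ord≥-^₁ (suc D) q-small) x-small)

  euler : ∀ {y} → Ord≥ 1 y → invPoch∞ y ≈ ∑ D (λ m → invQQ m * y ^ m)
  euler {y} y-small = begin
    invPoch∞ y                  ≈⟨ *-identityˡ _ ⟨
    1# * invPoch∞ y             ≈⟨ *-congʳ (poch-of-0 (zeroˡ y) (suc D)) ⟨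
    poch∞ (0# * y) * invPoch∞ y ≈⟨ q-binomial-theorem 0# y-small ⟨
    ₁φ₀ 0# y                    ≈⟨ ∑-cong D (λ m → *-congʳ (trans (*-congʳ (poch-of-0 refl m)) (*-identityˡ _))) ⟩
    ∑ D (λ m → invQQ m * y ^ m) ∎
    where
    poch-of-0 : ∀ {u} → u ≈ 0# → ∀ n → poch u n ≈ 1#
    poch-of-0 u≈0 n = ∏<-1# n (λ k → trans (+-congˡ (-‿cong (trans (*-congʳ u≈0) (zeroˡ _)))) 1-0≈1)

  ^-^-comm : ∀ x m n → (x ^ m) ^ n ≈ (x ^ n) ^ m
  ^-^-comm x m n = begin
    (x ^ m) ^ n   ≈⟨ ^-assocʳ x m n ⟩
    x ^ (m ℕ.* n) ≡⟨ ≡.cong (x ^_) (ℕₚ.*-comm m n) ⟩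
    x ^ (n ℕ.* m) ≈⟨ ^-assocʳ x n m ⟨
    (x ^ n) ^ m   ∎

  module Heine (a b : Carrier) (b-small : Ord≥ 1 b) where

    ₂φ₁ : Carrier → Carrier
    ₂φ₁ x = ∑ D (λ n → poch a n * poch b n * invQQ n * x ^ n)

    -- Write (b;q)ₙ = (b;q)∞/(bqⁿ;q)∞ and expand 1/(bqⁿ;q)∞ by Euler's formula;
    -- after exchanging the sums, the inner sum over n is ₁φ₀(a; qᵐx).
    heine : ∀ x → ₂φ₁ x ≈ poch∞ b * ∑ D (λ m → b ^ m * invQQ m * ₁φ₀ a (q ^ m * x))
    heine x = begin
      ₂φ₁ x
        ≈⟨ ∑-cong D (λ n → *-congʳ (*-congʳ (*-congˡ (trans (poch≈poch∞/poch∞ b-small n)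
                                                        (*-congˡ (euler (Ord≥-*ˡ _ b-small))))))) ⟩
      ∑ D (λ n → poch a n * (poch∞ b * ∑ D (λ m → invQQ m * (b * q ^ n) ^ m)) * invQQ n * x ^ n)
        ≈⟨ ∑-cong D (λ n → trans (factor-out n) (*-congˡ (*-distribˡ-∑ D _ _))) ⟩
      ∑ D (λ n → poch∞ b * ∑ D (λ m → T n * (invQQ m * (b * q ^ n) ^ m)))
        ≈⟨ *-distribˡ-∑ D _ _ ⟨
      poch∞ b * ∑ D (λ n → ∑ D (λ m → T n * (invQQ m * (b * q ^ n) ^ m)))
        ≈⟨ *-congˡ (∑-comm D D _) ⟩
      poch∞ b * ∑ D (λ m → ∑ D (λ n → T n * (invQQ m * (b * q ^ n) ^ m)))
        ≈⟨ *-congˡ (∑-cong D (λ m → trans (∑-cong D (regroup m)) (sym (*-distribˡ-∑ D _ _)))) ⟩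
      poch∞ b * ∑ D (λ m → b ^ m * invQQ m * ₁φ₀ a (q ^ m * x)) ∎
      where
      T : ℕ → Carrier
      T n = poch a n * invQQ n * x ^ n

      factor-out : ∀ n {P S} → poch a n * (P * S) * invQQ n * x ^ n ≈ P * (T n * S)
      factor-out n {P} {S} = solve 5 (λ A P S I X → A :* (P :* S) :* I :* X := P :* (A :* I :* X :* S)) refl
                               (poch a n) P S (invQQ n) (x ^ n)

      regroup : ∀ m n → T n * (invQQ m * (b * q ^ n) ^ m) ≈ b ^ m * invQQ m * (poch a n * invQQ n * (q ^ m * x) ^ n)
      regroup m n = begin
        T n * (invQQ m * (b * q ^ n) ^ m)
          ≈⟨ *-congˡ (*-congˡ (trans (^-distrib-* b (q ^ n) m) (*-congˡ (^-^-comm q n m)))) ⟩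
        T n * (invQQ m * (b ^ m * (q ^ m) ^ n))
          ≈⟨ solve 6 (λ A I X J B Q → A :* I :* X :* (J :* (B :* Q)) := B :* J :* (A :* I :* (Q :* X))) refl
               (poch a n) (invQQ n) (x ^ n) (invQQ m) (b ^ m) ((q ^ m) ^ n) ⟩
        b ^ m * invQQ m * (poch a n * invQQ n * ((q ^ m) ^ n * x ^ n))
          ≈⟨ *-congˡ (*-congˡ (^-distrib-* (q ^ m) x n)) ⟨
        b ^ m * invQQ m * (poch a n * invQQ n * (q ^ m * x) ^ n) ∎

  module Identity (a b c z : Carrier) (b-small : Ord≥ 1 b) (c-small : Ord≥ 1 c) (z-small : Ord≥ 1 z) where
    open Heine a b b-small public

    RR-term : Carrier → ℕ → Carrier
    RR-term w n = q ^ (n ℕ.* n) * w ^ n * invQQ n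

    RR : Carrier → Carrier
    RR w = ∑ D (RR-term w)

    qbinom : ℕ → ℕ → Carrier
    qbinom n k = poch q n * invQQ k * invQQ (n ∸ k)

    SnB : ℕ → Carrier
    SnB n = ∑ n (λ k → qbinom n k * q ^ (k ℕ.* k) * c ^ k * b ^ (n ∸ k))

    prefactor : Carrier
    prefactor = poch∞ b * poch∞ (a * z) * invPoch∞ z

    lhs-term rhs-term : ℕ → Carrier
    lhs-term n = RR (c * q ^ n) * poch a n * poch b n * invQQ n * z ^ n
    rhs-term n = SnB n * poch z n * invPoch (a * z) n * invQQ n

    lhs rhs : Carrier
    lhs = ∑ D lhs-term
    rhs = prefactor * ∑ D rhs-term

    weight : ℕ → Carrier
    weight k = q ^ (k ℕ.* k) * c ^ k * invQQ k

    lhs-expansion : lhs ≈ ∑ D (λ k → weight k * ₂φ₁ (z * q ^ k))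
    lhs-expansion = begin
      lhs
        ≈⟨ ∑-cong D (λ n → trans (pull-RR n) (*-distribʳ-∑ D _ _)) ⟩
      ∑ D (λ n → ∑ D (λ k → (q ^ (k ℕ.* k) * (c * q ^ n) ^ k * invQQ k) * U n))
        ≈⟨ ∑-cong D (λ n → ∑-cong D (λ k → regroup n k)) ⟩
      ∑ D (λ n → ∑ D (λ k → weight k * (poch a n * poch b n * invQQ n * (z * q ^ k) ^ n)))
        ≈⟨ ∑-comm D D _ ⟩
      ∑ D (λ k → ∑ D (λ n → weight k * (poch a n * poch b n * invQQ n * (z * q ^ k) ^ n)))
        ≈⟨ ∑-cong D (λ k → *-distribˡ-∑ D _ _) ⟨
      ∑ D (λ k → weight k * ₂φ₁ (z * q ^ k)) ∎
      where
      U : ℕ → Carrier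
      U n = poch a n * poch b n * invQQ n * z ^ n

      pull-RR : ∀ n → RR (c * q ^ n) * poch a n * poch b n * invQQ n * z ^ n ≈ RR (c * q ^ n) * U n
      pull-RR n = solve 5 (λ R A B I Z → R :* A :* B :* I :* Z := R :* (A :* B :* I :* Z)) refl
                    (RR (c * q ^ n)) (poch a n) (poch b n) (invQQ n) (z ^ n)

      regroup : ∀ n k → (q ^ (k ℕ.* k) * (c * q ^ n) ^ k * invQQ k) * U n
                        ≈ weight k * (poch a n * poch b n * invQQ n * (z * q ^ k) ^ n)
      regroup n k = begin
        (q ^ (k ℕ.* k) * (c * q ^ n) ^ k * invQQ k) * U n
          ≈⟨ *-congʳ (*-congʳ (*-congˡ (trans (^-distrib-* c (q ^ n) k) (*-congˡ (^-^-comm q n k))))) ⟩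
        (q ^ (k ℕ.* k) * (c ^ k * (q ^ k) ^ n) * invQQ k) * U n
          ≈⟨ solve 8 (λ Q C P I A B J Z → Q :* (C :* P) :* I :* (A :* B :* J :* Z) := Q :* C :* I :* (A :* B :* J :* (Z :* P))) refl
               (q ^ (k ℕ.* k)) (c ^ k) ((q ^ k) ^ n) (invQQ k) (poch a n) (poch b n) (invQQ n) (z ^ n) ⟩
        weight k * (poch a n * poch b n * invQQ n * (z ^ n * (q ^ k) ^ n))
          ≈⟨ *-congˡ (*-congˡ (^-distrib-* z (q ^ k) n)) ⟨
        weight k * (poch a n * poch b n * invQQ n * (z * q ^ k) ^ n) ∎

    tail : ℕ → ℕ → Carrier
    tail k m = b ^ m * invQQ m * (poch z (k ℕ.+ m) * invPoch (a * z) (k ℕ.+ m))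

    az-small : Ord≥ 1 (a * z)
    az-small = Ord≥-*ʳ a z-small

    ₂φ₁-at-zq^k : ∀ k → ₂φ₁ (z * q ^ k) ≈ prefactor * ∑ D (tail k)
    ₂φ₁-at-zq^k k = begin
      ₂φ₁ (z * q ^ k)
        ≈⟨ heine (z * q ^ k) ⟩
      poch∞ b * ∑ D (λ m → b ^ m * invQQ m * ₁φ₀ a (q ^ m * (z * q ^ k)))
        ≈⟨ *-congˡ (∑-cong D sum-inner) ⟩
      poch∞ b * ∑ D (λ m → (poch∞ (a * z) * invPoch∞ z) * tail k m)
        ≈⟨ *-congˡ (*-distribˡ-∑ D _ _) ⟨
      poch∞ b * ((poch∞ (a * z) * invPoch∞ z) * ∑ D (tail k))
        ≈⟨ solve 4 (λ P₁ P₂ P₃ S → P₁ :* (P₂ :* P₃ :* S) := P₁ :* P₂ :* P₃ :* S) refl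
             (poch∞ b) (poch∞ (a * z)) (invPoch∞ z) (∑ D (tail k)) ⟩
      prefactor * ∑ D (tail k) ∎
      where
      sum-inner : ∀ m → b ^ m * invQQ m * ₁φ₀ a (q ^ m * (z * q ^ k)) ≈ (poch∞ (a * z) * invPoch∞ z) * tail k m
      sum-inner m = begin
        b ^ m * invQQ m * ₁φ₀ a y
          ≈⟨ *-congˡ (q-binomial-theorem a (Ord≥-*ʳ _ (Ord≥-*ˡ _ z-small))) ⟩
        b ^ m * invQQ m * (poch∞ (a * y) * invPoch∞ y)
          ≈⟨ *-congˡ (*-cong (trans (poch-cong (suc D) ay≈azq^) (poch∞-shift az-small (k ℕ.+ m)))
                             (trans (invPoch-cong (suc D) y≈zq^) (invPoch∞-shift z-small (k ℕ.+ m)))) ⟩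
        b ^ m * invQQ m * ((invPoch (a * z) (k ℕ.+ m) * poch∞ (a * z)) * (poch z (k ℕ.+ m) * invPoch∞ z))
          ≈⟨ solve 6 (λ B I V P Z W → B :* I :* (V :* P :* (Z :* W)) := P :* W :* (B :* I :* (Z :* V))) refl
               (b ^ m) (invQQ m) (invPoch (a * z) (k ℕ.+ m)) (poch∞ (a * z)) (poch z (k ℕ.+ m)) (invPoch∞ z) ⟩
        (poch∞ (a * z) * invPoch∞ z) * tail k m ∎
        where
        y = q ^ m * (z * q ^ k)
        y≈zq^ : y ≈ z * q ^ (k ℕ.+ m)
        y≈zq^ = trans (solve 3 (λ Qm z Qk → Qm :* (z :* Qk) := z :* (Qk :* Qm)) refl (q ^ m) z (q ^ k))
                      (*-congˡ (sym (^-homo-* q k m)))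
        ay≈azq^ : a * y ≈ (a * z) * q ^ (k ℕ.+ m)
        ay≈azq^ = trans (*-congˡ y≈zq^) (sym (*-assoc _ _ _))

    summand : ℕ → ℕ → Carrier
    summand k m = weight k * tail k m

    Ord≥-summand : ∀ k m → Ord≥ (k ℕ.+ m) (summand k m)
    Ord≥-summand k m = Ord≥-* (Ord≥-*ˡ _ (Ord≥-*ʳ _ (Ord≥-^₁ k c-small)))
                              (Ord≥-*ˡ _ (Ord≥-*ˡ _ (Ord≥-^₁ m b-small)))

    rhs-coefficient : ∀ n → rhs-term n ≈ ∑ n (λ k → summand k (n ∸ k))
    rhs-coefficient n = begin
      SnB n * poch z n * invPoch (a * z) n * invQQ n
        ≈⟨ solve 4 (λ S Z V I → S :* Z :* V :* I := S :* (Z :* V :* I)) refl (SnB n) (poch z n) (invPoch (a * z) n) (invQQ n) ⟩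
      SnB n * W
        ≈⟨ *-distribʳ-∑ n W _ ⟩
      ∑ n (λ k → qbinom n k * q ^ (k ℕ.* k) * c ^ k * b ^ (n ∸ k) * W)
        ≈⟨ ∑-cong≤ n per-term ⟩
      ∑ n (λ k → summand k (n ∸ k)) ∎
      where
      W = poch z n * invPoch (a * z) n * invQQ n
      per-term : ∀ k → k ≤ n → qbinom n k * q ^ (k ℕ.* k) * c ^ k * b ^ (n ∸ k) * W ≈ summand k (n ∸ k)
      per-term k k≤n = begin
        qbinom n k * q ^ (k ℕ.* k) * c ^ k * b ^ (n ∸ k) * W
          ≈⟨ solve 9 (λ Pq Ik Il Qk Ck Bl Z V In → Pq :* Ik :* Il :* Qk :* Ck :* Bl :* (Z :* V :* In)
                                                  := Pq :* In :* (Qk :* Ck :* Ik :* (Bl :* Il :* (Z :* V)))) refl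
               (poch q n) (invQQ k) (invQQ (n ∸ k)) (q ^ (k ℕ.* k)) (c ^ k) (b ^ (n ∸ k)) (poch z n) (invPoch (a * z) n) (invQQ n) ⟩
        (poch q n * invQQ n) * (weight k * (b ^ (n ∸ k) * invQQ (n ∸ k) * (poch z n * invPoch (a * z) n)))
          ≈⟨ trans (*-congʳ (poch*invPoch q-small n)) (*-identityˡ _) ⟩
        weight k * (b ^ (n ∸ k) * invQQ (n ∸ k) * (poch z n * invPoch (a * z) n))
          ≡⟨ ≡.cong (λ j → weight k * (b ^ (n ∸ k) * invQQ (n ∸ k) * (poch z j * invPoch (a * z) j)))
                    (≡.sym (ℕₚ.m+[n∸m]≡n k≤n)) ⟩
        summand k (n ∸ k) ∎

    ∑-summand-pad : ∀ k → k ≤ D → ∑ (D ∸ k) (summand k) ≈ ∑ D (summand k)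
    ∑-summand-pad k k≤D = begin
      ∑ (D ∸ k) (summand k)         ≈⟨ ∑-pad (D ∸ k) k negligible ⟨
      ∑ (k ℕ.+ (D ∸ k)) (summand k) ≡⟨ ≡.cong (λ j → ∑ j (summand k)) (ℕₚ.m+[n∸m]≡n k≤D) ⟩
      ∑ D (summand k)               ∎
      where
      negligible : ∀ m → D ∸ k < m → m ≤ k ℕ.+ (D ∸ k) → summand k m ≈ 0#
      negligible m D∸k<m _ = small⇒≋0# (Ord≥-weaken D<k+m (Ord≥-summand k m))
        where
        D<k+m : suc D ≤ k ℕ.+ m
        D<k+m = ≡.subst (λ j → suc j ≤ k ℕ.+ m) (ℕₚ.m+[n∸m]≡n k≤D)
                  (≡.subst (_≤ k ℕ.+ m) (ℕₚ.+-suc k (D ∸ k)) (ℕₚ.+-monoʳ-≤ k D∸k<m))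

    rhs-expansion : rhs ≈ ∑ D (λ k → weight k * ₂φ₁ (z * q ^ k))
    rhs-expansion = begin
      prefactor * ∑ D rhs-term
        ≈⟨ *-congˡ (∑-cong D rhs-coefficient) ⟩
      prefactor * ∑ D (λ n → ∑ n (λ k → summand k (n ∸ k)))
        ≈⟨ *-congˡ (∑-triangle D (λ k n → summand k (n ∸ k))) ⟨
      prefactor * ∑ D (λ k → ∑ (D ∸ k) (λ t → summand k ((k ℕ.+ t) ∸ k)))
        ≈⟨ *-congˡ (∑-cong≤ D (λ k k≤D → trans (∑-cong (D ∸ k) (λ t → ≡⇒≈ (≡.cong (summand k) (ℕₚ.m+n∸m≡n k t))))
                                                (∑-summand-pad k k≤D))) ⟩
      prefactor * ∑ D (λ k → ∑ D (summand k))
        ≈⟨ *-congˡ (∑-cong D (λ k → *-distribˡ-∑ D (weight k) _)) ⟨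
      prefactor * ∑ D (λ k → weight k * ∑ D (tail k))
        ≈⟨ *-distribˡ-∑ D prefactor _ ⟩
      ∑ D (λ k → prefactor * (weight k * ∑ D (tail k)))
        ≈⟨ ∑-cong D (λ k → trans (x∙yz≈y∙xz prefactor (weight k) _) (*-congˡ (sym (₂φ₁-at-zq^k k)))) ⟩
      ∑ D (λ k → weight k * ₂φ₁ (z * q ^ k)) ∎

    lhs≈rhs : lhs ≈ rhs
    lhs≈rhs = trans lhs-expansion (sym rhs-expansion)

module S = FilteredRing Series⁵
module ℤ∑ = FilteredRing ℤ-filteredRing

degree-residual : ∀ N i j k l m → N ∸ i ∸ j ∸ k ∸ l ∸ m ≡ N ∸ deg i j k l m
degree-residual N i j k l m =
  ≡.trans (≡.cong (λ t → t ∸ k ∸ l ∸ m) (ℕₚ.∸-+-assoc N i j))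
  (≡.trans (≡.cong (λ t → t ∸ l ∸ m) (ℕₚ.∸-+-assoc N (i ℕ.+ j) k))
  (≡.trans (≡.cong (λ t → t ∸ m) (ℕₚ.∸-+-assoc N (i ℕ.+ j ℕ.+ k) l))
  (ℕₚ.∸-+-assoc N (i ℕ.+ j ℕ.+ k ℕ.+ l) m)))

Ord≥⇒low-coeff≡0 : ∀ {N f} → S.Ord≥ N f → ∀ i j k l m → deg i j k l m < N → f i j k l m ≡ 0ℤ
Ord≥⇒low-coeff≡0 {N} {f} f-small i j k l m d<N
  with N ∸ deg i j k l m | ℕₚ.m<n⇒0<n∸m d<N
     | ≡.subst (λ e → ℤ-Ord≥ e (f i j k l m)) (degree-residual N i j k l m) (f-small i j k l m)
... | suc _ | _ | f≡0 = f≡0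

low-coeff≡0⇒Ord≥ : ∀ {N f} → (∀ i j k l m → deg i j k l m < N → f i j k l m ≡ 0ℤ) → S.Ord≥ N f
low-coeff≡0⇒Ord≥ {N} {f} low≡0 i j k l m =
  ≡.subst (λ e → ℤ-Ord≥ e (f i j k l m)) (≡.sym (degree-residual N i j k l m)) (residual (N ∸ deg i j k l m) ≡.refl)
  where
  residual : ∀ r → N ∸ deg i j k l m ≡ r → ℤ-Ord≥ r (f i j k l m)
  residual zero    _  = tt
  residual (suc r) eq = low≡0 i j k l m (ℕₚ.m∸n≢0⇒n<m (λ eq′ → ℕₚ.0≢1+n (≡.trans (≡.sym eq′) eq)))

constant-term-0⇒Ord≥1 : ∀ {f : PS} → f 0 0 0 0 0 ≡ 0ℤ → S.Ord≥ 1 f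
constant-term-0⇒Ord≥1 {f} f₀≡0 = low-coeff≡0⇒Ord≥ degree-0
  where
  degree-0 : ∀ i j k l m → deg i j k l m < 1 → f i j k l m ≡ 0ℤ
  degree-0 zero zero zero zero zero _ = f₀≡0
  degree-0 zero zero zero zero (suc m) (s≤s ())
  degree-0 zero zero zero (suc l) m (s≤s ())
  degree-0 zero zero (suc k) l m (s≤s ())
  degree-0 zero (suc j) k l m (s≤s ())
  degree-0 (suc i) j k l m (s≤s ())

Q-small : S.Ord≥ 1 Q
Q-small = constant-term-0⇒Ord≥1 ≡.refl

B-small : S.Ord≥ 1 B
B-small = constant-term-0⇒Ord≥1 ≡.refl

C-small : S.Ord≥ 1 C
C-small = constant-term-0⇒Ord≥1 ≡.refl

Z-small : S.Ord≥ 1 Z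
Z-small = constant-term-0⇒Ord≥1 ≡.refl

𝟙≈1# : 𝟙 S.≈ S.1#
𝟙≈1# zero    zero    zero    zero    zero    = ≡.refl
𝟙≈1# zero    zero    zero    zero    (suc m) = ≡.refl
𝟙≈1# zero    zero    zero    (suc l) m       = ≡.refl
𝟙≈1# zero    zero    (suc k) l       m       = ≡.refl
𝟙≈1# zero    (suc j) k       l       m       = ≡.refl
𝟙≈1# (suc i) j       k       l       m       = ≡.refl

SnB-term : ℕ → ℕ → PS
SnB-term n k = Defs.qbinom n k ⊛ (Q ^^ (k ℕ.* k)) ⊛ (C ^^ k) ⊛ (B ^^ (n ∸ k))

-- SnB sums through a helper local to its where-block.  Unifying against one
-- unfolding of SnB names that helper; abstracting _+_, n, suc n and the last
-- term makes the unification problem a pattern and keeps the goal small.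
mutual
  SnB-partial : ℕ → ℕ → PS
  SnB-partial = _

  SnB-unfold : ∀ n i j k l m →
               Defs.SnB (suc n) i j k l m ≡ SnB-partial (suc n) n i j k l m ℤ.+ SnB-term (suc n) (suc n) i j k l m
  SnB-unfold n i j k l m with ℤ._+_ | n | suc n | SnB-term (suc n) (suc n) i j k l m
  ... | _ | _ | _ | _ = ≡.refl

SnB-partial≈∑ : ∀ n t → SnB-partial n t S.≈ S.∑ t (SnB-term n)
SnB-partial≈∑ n zero    i j k l m = ≡.refl
SnB-partial≈∑ n (suc t) i j k l m = ≡.cong (ℤ._+ SnB-term n (suc t) i j k l m) (SnB-partial≈∑ n t i j k l m)

module AtDegree (D : ℕ) where
  open Truncation Series⁵ D using (_≋_; mk≋; small-difference; ≈⇒≋)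
  open QSeries Series⁵ D Q Q-small
  open Identity A B C Z B-small C-small Z-small

  ≋⇒coeff≡ : ∀ {f g} → f ≋ g → ∀ i j k l m → deg i j k l m ≤ D → f i j k l m ≡ g i j k l m
  ≋⇒coeff≡ f≋g i j k l m d≤D = ℤₚ.i-j≡0⇒i≡j _ _ (Ord≥⇒low-coeff≡0 (small-difference f≋g) i j k l m (s≤s d≤D))

  coeff≡⇒≋ : ∀ {f g} → (∀ i j k l m → deg i j k l m ≤ D → f i j k l m ≡ g i j k l m) → f ≋ g
  coeff≡⇒≋ {f} {g} f≡g = mk≋ (low-coeff≡0⇒Ord≥ (λ i j k l m d<sD →
    ≡.trans (≡.cong (ℤ._- g i j k l m) (f≡g i j k l m (ℕₚ.≤-pred d<sD))) (ℤₚ.+-inverseʳ (g i j k l m))))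

  -- _⊛_ on the left lets implicit arguments be found by matching _⊛_ instead
  -- of unfolding both products to coefficient sums, where unification fails.
  ⊛-cong : ∀ {x y u v} → x ≈ y → u ≈ v → x ⊛ u ≈ y * v
  ⊛-cong = *-cong

  ⊖-cong : ∀ {x y u v} → x ≈ y → u ≈ v → x Defs.⊖ u ≈ y - v
  ⊖-cong x≈y u≈v = +-cong x≈y (-‿cong u≈v)

  Σ∞≋∑ : ∀ (f : ℕ → PS) {f′} → (∀ n → n ≤ D → f n ≈ f′ n) → (∀ n → n ≤ D → S.Ord≥ n (f′ n)) →
         Σ∞ f ≈ S.∑ D f′
  Σ∞≋∑ f {f′} f≈f′ f′-small = coeff≡⇒≋ coeff
    where
    open ≡.≡-Reasoning
    coeff : ∀ i j k l m → deg i j k l m ≤ D → Σ∞ f i j k l m ≡ S.∑ D f′ i j k l m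
    coeff i j k l m d≤D = begin
      ℤ∑.∑ d (λ n → f n i j k l m)
        ≡⟨ ℤ∑.∑-cong≤ d (λ n n≤d → ≋⇒coeff≡ (f≈f′ n (ℕₚ.≤-trans n≤d d≤D)) i j k l m d≤D) ⟩
      ℤ∑.∑ d (λ n → f′ n i j k l m)
        ≡⟨ ℤ∑.∑-pad d (D ∸ d) vanishing ⟨
      ℤ∑.∑ (D ∸ d ℕ.+ d) (λ n → f′ n i j k l m)
        ≡⟨ ≡.cong (λ t → ℤ∑.∑ t (λ n → f′ n i j k l m)) (ℕₚ.m∸n+n≡m d≤D) ⟩
      ℤ∑.∑ D (λ n → f′ n i j k l m) ∎
      where
      d = deg i j k l m
      vanishing : ∀ n → d < n → n ≤ D ∸ d ℕ.+ d → f′ n i j k l m ≡ 0ℤ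
      vanishing n d<n n≤D = Ord≥⇒low-coeff≡0 (f′-small n (≡.subst (n ≤_) (ℕₚ.m∸n+n≡m d≤D) n≤D)) i j k l m d<n

  Π<≋∏< : ∀ n {f g : ℕ → PS} → (∀ k → k < n → f k ≈ g k) → Π< n f ≈ ∏< n g
  Π<≋∏< zero    f≈g = ≈⇒≋ 𝟙≈1#
  Π<≋∏< (suc n) f≈g = ⊛-cong (Π<≋∏< n (λ k k<n → f≈g k (ℕₚ.m≤n⇒m≤1+n k<n))) (f≈g n ℕₚ.≤-refl)

  Π∞≋∏< : ∀ (f : ℕ → PS) {f′} → (∀ k → k ≤ D → f k ≈ f′ k) → (∀ k → S.Ord≥ (suc k) (f′ k S.- S.1#)) →
          Π∞ f ≈ ∏< (suc D) f′
  Π∞≋∏< f {f′} f≈f′ f′-near-1 = coeff≡⇒≋ coeff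
    where
    open ≡.≡-Reasoning
    coeff : ∀ i j k l m → deg i j k l m ≤ D → Π∞ f i j k l m ≡ ∏< (suc D) f′ i j k l m
    coeff i j k l m d≤D = begin
      Π< (suc d) f i j k l m
        ≡⟨ ≋⇒coeff≡ (Π<≋∏< (suc d) (λ t t<sd → f≈f′ t (ℕₚ.≤-trans (ℕₚ.≤-pred t<sd) d≤D))) i j k l m d≤D ⟩
      ∏< (suc d) f′ i j k l m
        ≡⟨ tail-vanishes ⟨
      ∏< (D ∸ d ℕ.+ suc d) f′ i j k l m
        ≡⟨ ≡.cong (λ t → ∏< t f′ i j k l m) (≡.trans (ℕₚ.+-suc (D ∸ d) d) (≡.cong suc (ℕₚ.m∸n+n≡m d≤D))) ⟩
      ∏< (suc D) f′ i j k l m ∎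
      where
      d = deg i j k l m
      tail-vanishes : ∏< (D ∸ d ℕ.+ suc d) f′ i j k l m ≡ ∏< (suc d) f′ i j k l m
      tail-vanishes = ℤₚ.i-j≡0⇒i≡j (∏< (D ∸ d ℕ.+ suc d) f′ i j k l m) (∏< (suc d) f′ i j k l m)
        (Ord≥⇒low-coeff≡0 (∏<-stable f′-near-1 (D ∸ d) (suc d)) i j k l m ℕₚ.≤-refl)

  ⊛-congˡ : ∀ x {u v} → u ≈ v → x ⊛ u ≈ x * v
  ⊛-congˡ x = ⊛-cong (refl {x})

  ^^≋^ : ∀ x n → x ^^ n ≈ x ^ n
  ^^≋^ x zero    = ≈⇒≋ 𝟙≈1#
  ^^≋^ x (suc n) = ⊛-congˡ x (^^≋^ x n)

  geom≋ : ∀ {y y′} → S.Ord≥ 1 y′ → y ≈ y′ → Defs.geom y ≈ geom y′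
  geom≋ {y} {y′} y′-small y≈y′ =
    Σ∞≋∑ (y ^^_) {y′ ^_} (λ n _ → trans (^^≋^ y n) (^-congˡ n y≈y′)) (λ n _ → Ord≥-^₁ n y′-small)

  poch-factor≋ : ∀ x k → 𝟙 Defs.⊖ x ⊛ (Q ^^ k) ≈ 1# - x * Q ^ k
  poch-factor≋ x k = ⊖-cong (≈⇒≋ 𝟙≈1#) (⊛-congˡ x (^^≋^ Q k))

  invPoch-factor≋ : ∀ {x} → S.Ord≥ 1 x → ∀ k → Defs.geom (x ⊛ (Q ^^ k)) ≈ geom (x * Q ^ k)
  invPoch-factor≋ {x} x-small k = geom≋ (S.Ord≥-*ˡ (Q ^ k) x-small) (⊛-congˡ x (^^≋^ Q k))

  poch≋ : ∀ x n → Defs.poch x n ≈ poch x n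
  poch≋ x n = Π<≋∏< n (λ k _ → poch-factor≋ x k)

  invPoch≋ : ∀ {x} → S.Ord≥ 1 x → ∀ n → Defs.invPoch x n ≈ invPoch x n
  invPoch≋ x-small n = Π<≋∏< n (λ k _ → invPoch-factor≋ x-small k)

  invQQ≋ : ∀ n → Defs.invQQ n ≈ invQQ n
  invQQ≋ n = Π<≋∏< n (λ k _ → geom≋ (S.Ord≥-*ˡ (Q ^ k) Q-small) (^^≋^ Q (suc k)))

  poch∞≋ : ∀ {x} → S.Ord≥ 1 x → Defs.poch∞ x ≈ poch∞ x
  poch∞≋ {x} x-small = Π∞≋∏< (λ k → 𝟙 Defs.⊖ x ⊛ (Q ^^ k)) {poch-factor x}
    (λ k _ → poch-factor≋ x k) (poch-factor-near-1 x-small)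

  invPoch∞≋ : ∀ {x} → S.Ord≥ 1 x → Defs.invPoch∞ x ≈ invPoch∞ x
  invPoch∞≋ {x} x-small = Π∞≋∏< (λ k → Defs.geom (x ⊛ (Q ^^ k))) {invPoch-factor x}
    (λ k _ → invPoch-factor≋ x-small k) (invPoch-factor-near-1 x-small)

  RR-term≋ : ∀ {w w′} → S.Ord≥ 1 w′ → w ≈ w′ → ∀ n →
             (Q ^^ (n ℕ.* n)) ⊛ (w ^^ n) ⊛ Defs.invQQ n ≈ Q ^ (n ℕ.* n) * w′ ^ n * invQQ n
  RR-term≋ {w} w′-small w≈w′ n = ⊛-cong (⊛-cong (^^≋^ Q (n ℕ.* n)) (trans (^^≋^ w n) (^-congˡ n w≈w′))) (invQQ≋ n)

  RR≋ : ∀ {w w′} → S.Ord≥ 1 w′ → w ≈ w′ → Defs.RR w ≈ RR w′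
  RR≋ {w} {w′} w′-small w≈w′ = Σ∞≋∑ (λ n → (Q ^^ (n ℕ.* n)) ⊛ (w ^^ n) ⊛ Defs.invQQ n) {RR-term w′}
    (λ n _ → RR-term≋ w′-small w≈w′ n)
    (λ n _ → S.Ord≥-*ˡ (invQQ n) (S.Ord≥-*ʳ (Q ^ (n ℕ.* n)) (Ord≥-^₁ n w′-small)))

  SnB-term≋ : ∀ n k → SnB-term n k ≈ qbinom n k * Q ^ (k ℕ.* k) * C ^ k * B ^ (n ∸ k)
  SnB-term≋ n k = ⊛-cong (⊛-cong (⊛-cong (⊛-cong (⊛-cong (poch≋ Q n) (invQQ≋ k)) (invQQ≋ (n ∸ k)))
                    (^^≋^ Q (k ℕ.* k))) (^^≋^ C k)) (^^≋^ B (n ∸ k))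

  SnB≋ : ∀ n → Defs.SnB n ≈ SnB n
  SnB≋ n = trans (≈⇒≋ (SnB-partial≈∑ n n)) (∑-cong n (SnB-term≋ n))

  LHS-term≋ : ∀ n → Defs.RR (C ⊛ (Q ^^ n)) ⊛ Defs.poch A n ⊛ Defs.poch B n ⊛ Defs.invQQ n ⊛ (Z ^^ n)
                    ≈ RR (C * Q ^ n) * poch A n * poch B n * invQQ n * Z ^ n
  LHS-term≋ n = ⊛-cong (⊛-cong (⊛-cong (⊛-cong (RR≋ (S.Ord≥-*ˡ (Q ^ n) C-small) (⊛-congˡ C (^^≋^ Q n)))
                  (poch≋ A n)) (poch≋ B n)) (invQQ≋ n)) (^^≋^ Z n)

  RHS-term≋ : ∀ n → Defs.SnB n ⊛ Defs.poch Z n ⊛ Defs.invPoch (A ⊛ Z) n ⊛ Defs.invQQ n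
                    ≈ SnB n * poch Z n * invPoch (A * Z) n * invQQ n
  RHS-term≋ n = ⊛-cong (⊛-cong (⊛-cong (SnB≋ n) (poch≋ Z n)) (invPoch≋ az-small n)) (invQQ≋ n)

  LHS≋lhs : LHS ≈ lhs
  LHS≋lhs = Σ∞≋∑ (λ n → Defs.RR (C ⊛ (Q ^^ n)) ⊛ Defs.poch A n ⊛ Defs.poch B n ⊛ Defs.invQQ n ⊛ (Z ^^ n)) {lhs-term}
    (λ n _ → LHS-term≋ n) (λ n _ → S.Ord≥-*ʳ (RR (C * Q ^ n) * poch A n * poch B n * invQQ n) (Ord≥-^₁ n Z-small))

  Ord≥-SnB : ∀ n → S.Ord≥ n (SnB n)
  Ord≥-SnB n = S.Ord≥-∑ n (λ k k≤n → S.Ord≥-weaken (ℕₚ.≤-reflexive (≡.sym (ℕₚ.m+[n∸m]≡n k≤n)))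
    (S.Ord≥-* (S.Ord≥-*ʳ (qbinom n k * Q ^ (k ℕ.* k)) (Ord≥-^₁ k C-small)) (Ord≥-^₁ (n ∸ k) B-small)))

  RHS≋rhs : RHS ≈ rhs
  RHS≋rhs = ⊛-cong (⊛-cong (⊛-cong (poch∞≋ B-small) (poch∞≋ az-small)) (invPoch∞≋ Z-small))
    (Σ∞≋∑ (λ n → Defs.SnB n ⊛ Defs.poch Z n ⊛ Defs.invPoch (A ⊛ Z) n ⊛ Defs.invQQ n) {rhs-term}
      (λ n _ → RHS-term≋ n)
      (λ n _ → S.Ord≥-*ˡ (invQQ n) (S.Ord≥-*ˡ (invPoch (A * Z) n) (S.Ord≥-*ˡ (poch Z n) (Ord≥-SnB n)))))

  LHS≋RHS : LHS ≈ RHS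
  LHS≋RHS = trans LHS≋lhs (trans lhs≈rhs (sym RHS≋rhs))

mainTheorem16 : (i j k l m : ℕ) → LHS i j k l m ≡ RHS i j k l m
mainTheorem16 i j k l m = AtDegree.≋⇒coeff≡ d (AtDegree.LHS≋RHS d) i j k l m ℕₚ.≤-refl
  where
  d = deg i j k l m
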